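{- Let $R$ be a commutative ring and let $U(x,y)\in R[x,y]$ be an $(n,r)$-Brylawski polynomial. Then $\deg_xU\geq r$ and $\deg_yU\geq n-r$. Moreover, if $R$ is a unique factorization domain, then any univariate factor of $U(x,y)$ (a divisor of $U$ in $R[x,y]$ lying in $R[x]$ or in $R[y]$) is necessarily of the form $a(x-1)^kx^\ell$ or $b(y-1)^ky^\ell$ for some $a,b\in R\setminus\{0\}$ and $k,\ell\in\mathbf{Z}_{\geq 0}$.
   Context: For a commutative ring $R$, $U(x,y)\in R[x,y]$ is an $(n,r)$-Brylawski polynomial (with constant $c$) if $(y-1)^rU\big(\frac{y}{y-1},y\big)=cy^n$ for some non-negative integer $n$, integer $r$, and non-zero $c\in R$; equivalently $(x-1)^{n-r}U\big(x,\frac{x}{x-1}\big)=cx^n$. For $U=\sum u_{i,j}x^iy^j$, $\deg_x U=\max\{i:\exists j,\ u_{i,j}\neq 0\}$ and $\deg_y U=\max\{j:\exists i,\ u_{i,j}\neq 0\}$. -}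

module Defs where

open import Level using (_⊔_)
open import Algebra.Bundles using (CommutativeRing)
open import Data.Nat as ℕ using (ℕ; zero; suc; _∸_)
open import Data.Integer as ℤ using (ℤ; +_)
open import Data.List using (List; foldr)
open import Data.List.Relation.Unary.All using (All)
open import Data.List.Relation.Binary.Pointwise using (Pointwise)
open import Data.List.Relation.Binary.Permutation.Propositional using (_↭_)
open import Data.Product using (Σ; ∃; ∃-syntax; _×_)
open import Data.Sum using (_⊎_)
open import Relation.Nullary using (¬_)
open import Relation.Binary.PropositionalEquality using (_≡_)

module Poly {c ℓ} (R : CommutativeRing c ℓ) where
  open CommutativeRing R

  IsUnit : Carrier → Set (c ⊔ ℓ)
  IsUnit a = ∃[ b ] (a * b ≈ 1#)

  IsIrreducible : Carrier → Set (c ⊔ ℓ)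
  IsIrreducible p = ¬ (p ≈ 0#) × ¬ IsUnit p
                    × (∀ a b → a * b ≈ p → IsUnit a ⊎ IsUnit b)

  Associated : Carrier → Carrier → Set (c ⊔ ℓ)
  Associated a b = ∃[ u ] (IsUnit u × a * u ≈ b)

  prod : List Carrier → Carrier
  prod = foldr _*_ 1#

  record IsUFD : Set (c ⊔ ℓ) where
    field
      one≉zero    : ¬ (1# ≈ 0#)
      noZeroDiv   : ∀ a b → a * b ≈ 0# → a ≈ 0# ⊎ b ≈ 0#
      factor      : ∀ a → ¬ (a ≈ 0#) → ¬ IsUnit a →
                    ∃[ ps ] (All IsIrreducible ps × prod ps ≈ a)
      unique      : ∀ ps qs → All IsIrreducible ps → All IsIrreducible qs →
                    prod ps ≈ prod qs →
                    ∃[ ps′ ] (ps ↭ ps′ × Pointwise Associated ps′ qs)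

  sumTo : ℕ → (ℕ → Carrier) → Carrier
  sumTo zero    f = f 0
  sumTo (suc n) f = sumTo n f + f (suc n)

  sumBelow : ℕ → (ℕ → Carrier) → Carrier
  sumBelow zero    f = 0#
  sumBelow (suc n) f = sumBelow n f + f n

  Seq : Set c
  Seq = ℕ → Carrier

  _≋_ : Seq → Seq → Set ℓ
  f ≋ g = ∀ k → f k ≈ g k

  IsPoly : Seq → Set ℓ
  IsPoly f = ∃[ B ] (∀ k → B ℕ.≤ k → f k ≈ 0#)

  _⊕_ : Seq → Seq → Seq
  (f ⊕ g) k = f k + g k

  _⊛_ : Seq → Seq → Seq
  (f ⊛ g) n = sumTo n (λ k → f k * g (n ∸ k))

  cst : Carrier → Seq
  cst a zero    = a
  cst a (suc _) = 0#

  X : Seq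
  X 1 = 1#
  X _ = 0#

  X-1 : Seq
  X-1 = X ⊕ cst (- 1#)

  _^ˢ_ : Seq → ℕ → Seq
  f ^ˢ zero  = cst 1#
  f ^ˢ suc k = f ⊛ (f ^ˢ k)

  sumSeq : ℕ → (ℕ → Seq) → Seq
  sumSeq n F k = sumBelow n (λ i → F i k)

  -- Bivariate polynomials: U i j is the coefficient of x^i y^j

  Seq₂ : Set c
  Seq₂ = ℕ → ℕ → Carrier

  _≋₂_ : Seq₂ → Seq₂ → Set ℓ
  F ≋₂ G = ∀ i j → F i j ≈ G i j

  Support₂ : Seq₂ → ℕ → Set ℓ
  Support₂ U B = ∀ i j → B ℕ.≤ i ⊎ B ℕ.≤ j → U i j ≈ 0#

  IsPoly₂ : Seq₂ → Set ℓ
  IsPoly₂ U = ∃[ B ] Support₂ U B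

  _⊛₂_ : Seq₂ → Seq₂ → Seq₂
  (F ⊛₂ G) n m = sumTo n (λ i → sumTo m (λ j → F i j * G (n ∸ i) (m ∸ j)))

  embedX : Seq → Seq₂
  embedX f i zero    = f i
  embedX f i (suc _) = 0#

  embedY : Seq → Seq₂
  embedY f zero    j = f j
  embedY f (suc _) j = 0#

  DividesX : Seq → Seq₂ → Set (c ⊔ ℓ)
  DividesX f U = ∃[ G ] (IsPoly₂ G × (embedX f ⊛₂ G) ≋₂ U)

  DividesY : Seq → Seq₂ → Set (c ⊔ ℓ)
  DividesY f U = ∃[ G ] (IsPoly₂ G × (embedY f ⊛₂ G) ≋₂ U)

  -- For U with Support₂ U B and D ≥ B,
  --   P U B D (y) = (y-1)^D · U(y/(y-1), y) = Σ_{i,j<B} u_ij y^(i+j) (y-1)^(D-i) ∈ R[y].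
  -- The identity (y-1)^r U(y/(y-1),y) = c y^n is an identity in the
  -- localisation R[y][(y-1)^{-1}], i.e. writing r = p - q (p q : ℕ):
  --   (y-1)^p · P/(y-1)^D = c y^n (y-1)^q / 1, which by the definition of
  -- equality of fractions means (y-1)^(s+p) · P = (y-1)^(s+q+D) · c y^n for some s.

  substY : Seq₂ → ℕ → ℕ → Seq
  substY U B D = sumSeq B (λ i → sumSeq B (λ j →
                   cst (U i j) ⊛ ((X ^ˢ (i ℕ.+ j)) ⊛ (X-1 ^ˢ (D ∸ i)))))

  IsBrylawski : Seq₂ → ℕ → ℤ → Carrier → Set ℓ
  IsBrylawski U n r κ =
    ¬ (κ ≈ 0#) ×
    ∃[ B ] (Support₂ U B × ∃[ D ] (B ℕ.≤ D × ∃[ p ] ∃[ q ] ∃[ s ]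
      (r ≡ + p ℤ.- + q ×
       ((X-1 ^ˢ (s ℕ.+ p)) ⊛ substY U B D)
         ≋ ((X-1 ^ˢ (s ℕ.+ q ℕ.+ D)) ⊛ (cst κ ⊛ (X ^ˢ n))))))

  -- Degrees.  deg_x U ≥ d  means  ¬ (every coefficient u_ij with i ≥ d vanishes);
  -- (classically: some u_ij ≠ 0 with i ≥ d, i.e. max{i : ∃ j, u_ij ≠ 0} ≥ d,
  -- with deg of the zero polynomial = -∞).

  DegX≥ : Seq₂ → ℤ → Set ℓ
  DegX≥ U d = ¬ (∀ i j → d ℤ.≤ + i → U i j ≈ 0#)

  DegY≥ : Seq₂ → ℤ → Set ℓ
  DegY≥ U d = ¬ (∀ i j → d ℤ.≤ + j → U i j ≈ 0#)

  SpecialForm : Seq → Set (c ⊔ ℓ)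
  SpecialForm f = ∃[ a ] ∃[ k ] ∃[ l ]
    (¬ (a ≈ 0#) × f ≋ (cst a ⊛ ((X-1 ^ˢ k) ⊛ (X ^ˢ l))))

{-# OPTIONS --safe #-}
-- Write P(y) = (y - 1)^D U(y/(y - 1), y) = Σ u_ij y^(i+j) (y - 1)^(D-i); the Brylawski identity says
-- (y - 1)^(s+p) P = (y - 1)^(s+q+D) κ yⁿ with r = p - q. If every monomial of U had x-degree below r,
-- then after cancelling (y - 1)^(s+q+D) the left-hand side would keep a factor y - 1 and vanish at
-- y = 1, unlike κ yⁿ. If every monomial had y-degree below n - r, the left-hand side would have
-- degree below that of the right-hand side.
--
-- U ↦ (y - 1)^D U(y/(y - 1), y) is multiplicative, so a univariate factor f of U gives a divisor of
-- κ yⁿ (y - 1)^m in R[y]: f (y - 1)^d when f ∈ R[y], and (y - 1)^d f(y/(y - 1)) when f ∈ R[x].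
-- Over a domain y and y - 1 are prime and divisors of nonzero constants are constants, so that
-- divisor is b yᵃ (y - 1)ᵉ; this holds only up to double negation, as it requires deciding which
-- coefficients vanish. For f ∈ R[x] one transports the form back, x ↦ x/(x - 1) being an involution.
module Submission where

open import Algebra.Bundles using (CommutativeRing)
open import Data.Nat as ℕ using (ℕ; zero; suc; _∸_; z≤n; s≤s; _<_; _≤_)
import Data.Nat.Properties as ℕP
open import Data.Product using (∃-syntax; _×_; _,_; proj₁; proj₂)
open import Data.Sum using (_⊎_; inj₁; inj₂)
open import Function using (_∘_)
open import Relation.Nullary using (¬_; yes; no; contradiction; ¬¬-map)
open import Relation.Nullary.Decidable using (¬¬-excluded-middle)
open import Level using (_⊔_)
open import Relation.Binary.PropositionalEquality as ≡ using (_≡_; _≢_)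
import Relation.Binary.Reasoning.Setoid
open import Defs

¬¬-bind : ∀ {a b} {A : Set a} {B : Set b} → ¬ ¬ A → (A → ¬ ¬ B) → ¬ ¬ B
¬¬-bind ¬¬a f ¬b = ¬¬a (λ a → f a ¬b)

module Sums {c ℓ} (R : CommutativeRing c ℓ) where
  open CommutativeRing R
  open Poly R using (sumBelow; sumTo; Support₂; _⊛₂_)
  open import Relation.Binary.Reasoning.Setoid setoid

  sumTo≈sumBelow : ∀ n f → sumTo n f ≈ sumBelow (suc n) f
  sumTo≈sumBelow zero    f = sym (+-identityˡ _)
  sumTo≈sumBelow (suc n) f = +-congʳ (sumTo≈sumBelow n f)

  sumBelow-cong : ∀ n {f g} → (∀ i → i < n → f i ≈ g i) → sumBelow n f ≈ sumBelow n g
  sumBelow-cong zero    f≈g = refl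
  sumBelow-cong (suc n) f≈g =
    +-cong (sumBelow-cong n (λ i i<n → f≈g i (ℕP.m<n⇒m<1+n i<n))) (f≈g n (ℕP.n<1+n n))

  sumBelow-zero : ∀ n {f} → (∀ i → i < n → f i ≈ 0#) → sumBelow n f ≈ 0#
  sumBelow-zero zero    f≈0 = refl
  sumBelow-zero (suc n) f≈0 =
    trans (+-cong (sumBelow-zero n (λ i i<n → f≈0 i (ℕP.m<n⇒m<1+n i<n))) (f≈0 n (ℕP.n<1+n n)))
          (+-identityˡ 0#)

  sumBelow-distrib-+ : ∀ n (f g : ℕ → Carrier) →
                       sumBelow n (λ i → f i + g i) ≈ sumBelow n f + sumBelow n g
  sumBelow-distrib-+ zero    f g = sym (+-identityˡ 0#)
  sumBelow-distrib-+ (suc n) f g = begin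
    sumBelow n (λ i → f i + g i) + (f n + g n)   ≈⟨ +-congʳ (sumBelow-distrib-+ n f g) ⟩
    (sumBelow n f + sumBelow n g) + (f n + g n)  ≈⟨ +-medial _ _ _ _ ⟩
    (sumBelow n f + f n) + (sumBelow n g + g n)  ∎
    where open import Algebra.Properties.CommutativeSemigroup +-commutativeSemigroup
                using () renaming (interchange to +-medial)

  *-distribˡ-sumBelow : ∀ n a (f : ℕ → Carrier) → a * sumBelow n f ≈ sumBelow n (λ i → a * f i)
  *-distribˡ-sumBelow zero    a f = zeroʳ a
  *-distribˡ-sumBelow (suc n) a f = trans (distribˡ a _ _) (+-congʳ (*-distribˡ-sumBelow n a f))

  *-distribʳ-sumBelow : ∀ n a (f : ℕ → Carrier) → sumBelow n f * a ≈ sumBelow n (λ i → f i * a)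
  *-distribʳ-sumBelow n a f =
    trans (*-comm _ a) (trans (*-distribˡ-sumBelow n a f) (sumBelow-cong n (λ i _ → *-comm a (f i))))

  sumBelow-comm : ∀ n m (F : ℕ → ℕ → Carrier) →
                  sumBelow n (λ i → sumBelow m (F i)) ≈ sumBelow m (λ j → sumBelow n (λ i → F i j))
  sumBelow-comm zero    m F = sym (sumBelow-zero m (λ _ _ → refl))
  sumBelow-comm (suc n) m F = begin
    sumBelow n (λ i → sumBelow m (F i)) + sumBelow m (F n)          ≈⟨ +-congʳ (sumBelow-comm n m F) ⟩
    sumBelow m (λ j → sumBelow n (λ i → F i j)) + sumBelow m (F n)  ≈⟨ sym (sumBelow-distrib-+ m _ _) ⟩
    sumBelow m (λ j → sumBelow n (λ i → F i j) + F n j)             ∎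

  sumBelow-suc : ∀ n (f : ℕ → Carrier) → sumBelow (suc n) f ≈ f 0 + sumBelow n (f ∘ suc)
  sumBelow-suc zero    f = trans (+-identityˡ _) (sym (+-identityʳ _))
  sumBelow-suc (suc n) f = trans (+-congʳ (sumBelow-suc n f)) (+-assoc _ _ _)

  sumBelow-extend : ∀ {n} m {f} → n ≤ m → (∀ i → n ≤ i → i < m → f i ≈ 0#) →
                    sumBelow m f ≈ sumBelow n f
  sumBelow-extend zero    z≤n   _      = refl
  sumBelow-extend (suc m) n≤1+m vanish with ℕP.m≤n⇒m<n∨m≡n n≤1+m
  ... | inj₂ ≡.refl      = refl
  ... | inj₁ (s≤s n≤m) =
    trans (+-cong (sumBelow-extend m n≤m (λ i n≤i i<m → vanish i n≤i (ℕP.m<n⇒m<1+n i<m)))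
                  (vanish m n≤m (ℕP.n<1+n m)))
          (+-identityʳ _)

  sumBelow-single : ∀ n k {f} → k < n → (∀ i → i < n → i ≢ k → f i ≈ 0#) → sumBelow n f ≈ f k
  sumBelow-single (suc n) k k<1+n vanish with k ℕP.≟ n
  ... | yes ≡.refl =
    trans (+-congʳ (sumBelow-zero n (λ i i<n → vanish i (ℕP.m<n⇒m<1+n i<n) (ℕP.<⇒≢ i<n))))
          (+-identityˡ _)
  ... | no k≢n =
    trans (+-cong (sumBelow-single n k (ℕP.≤∧≢⇒< (ℕP.≤-pred k<1+n) k≢n)
                                       (λ i i<n → vanish i (ℕP.m<n⇒m<1+n i<n)))
                  (vanish n (ℕP.n<1+n n) (k≢n ∘ ≡.sym)))
          (+-identityʳ _)

  sumBelow-reverse : ∀ n (f : ℕ → Carrier) → sumBelow n (λ i → f (n ∸ suc i)) ≈ sumBelow n f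
  sumBelow-reverse zero    f = refl
  sumBelow-reverse (suc n) f = begin
    sumBelow (suc n) (λ i → f (n ∸ i))   ≈⟨ sumBelow-suc n _ ⟩
    f n + sumBelow n (λ i → f (n ∸ suc i)) ≈⟨ +-congˡ (sumBelow-reverse n f) ⟩
    f n + sumBelow n f                      ≈⟨ +-comm _ _ ⟩
    sumBelow n f + f n                      ∎

  sumBelow-antidiagonals : ∀ N (G : ℕ → ℕ → Carrier) →
    sumBelow N (λ k → sumBelow (suc k) (λ a → G a (k ∸ a))) ≈ sumBelow N (λ a → sumBelow (N ∸ a) (G a))
  sumBelow-antidiagonals zero    G = refl
  sumBelow-antidiagonals (suc N) G = begin
    sumBelow N (λ k → sumBelow (suc k) (λ a → G a (k ∸ a))) + sumBelow (suc N) (λ a → G a (N ∸ a))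
      ≈⟨ +-congʳ (trans (sumBelow-antidiagonals N G) (sym (trans (+-congˡ lastRowEmpty) (+-identityʳ _)))) ⟩
    sumBelow (suc N) (λ a → sumBelow (N ∸ a) (G a)) + sumBelow (suc N) (λ a → G a (N ∸ a))
      ≈⟨ sym (sumBelow-distrib-+ (suc N) _ _) ⟩
    sumBelow (suc N) (λ a → sumBelow (suc (N ∸ a)) (G a))
      ≈⟨ sumBelow-cong (suc N) (λ a a<1+N → reflexive (≡.cong (λ t → sumBelow t (G a))
                                                        (≡.sym (ℕP.+-∸-assoc 1 (ℕP.≤-pred a<1+N))))) ⟩
    sumBelow (suc N) (λ a → sumBelow (suc N ∸ a) (G a))  ∎
    where
      lastRowEmpty : sumBelow (N ∸ N) (G N) ≈ 0#
      lastRowEmpty = reflexive (≡.cong (λ t → sumBelow t (G N)) (ℕP.n∸n≡0 N))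

  sumBelow-cauchy : ∀ {A B} N (H : ℕ → ℕ → Carrier) → A ℕ.+ B ≤ N →
                    (∀ a b → A ≤ a → H a b ≈ 0#) → (∀ a b → B ≤ b → H a b ≈ 0#) →
                    sumBelow N (λ k → sumBelow (suc k) (λ a → H a (k ∸ a))) ≈
                    sumBelow A (λ a → sumBelow B (H a))
  sumBelow-cauchy {A} {B} N H A+B≤N vanishᴬ vanishᴮ = begin
    sumBelow N (λ k → sumBelow (suc k) (λ a → H a (k ∸ a)))  ≈⟨ sumBelow-antidiagonals N H ⟩
    sumBelow N (λ a → sumBelow (N ∸ a) (H a))               ≈⟨ sumBelow-cong N row ⟩
    sumBelow N (λ a → sumBelow B (H a))                     ≈⟨ sumBelow-extend N (ℕP.m+n≤o⇒m≤o A A+B≤N) vanishingRow ⟩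
    sumBelow A (λ a → sumBelow B (H a))                     ∎
    where
      vanishingRow : ∀ a → A ≤ a → a < N → sumBelow B (H a) ≈ 0#
      vanishingRow a A≤a _ = sumBelow-zero B (λ b _ → vanishᴬ a b A≤a)
      row : ∀ a → a < N → sumBelow (N ∸ a) (H a) ≈ sumBelow B (H a)
      row a a<N with a ℕP.<? A
      ... | yes a<A = sumBelow-extend (N ∸ a) B≤N∸a (λ b B≤b _ → vanishᴮ a b B≤b)
        where B≤N∸a = ℕP.m+n≤o⇒m≤o∸n B (ℕP.≤-trans (ℕP.+-monoʳ-≤ B (ℕP.<⇒≤ a<A))
                                                      (ℕP.≤-trans (ℕP.≤-reflexive (ℕP.+-comm B A)) A+B≤N))
      ... | no a≮A  = trans (sumBelow-zero (N ∸ a) (λ b _ → vanishᴬ a b (ℕP.≮⇒≥ a≮A)))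
                            (sym (vanishingRow a (ℕP.≮⇒≥ a≮A) a<N))

  sumBelow-cauchy₂ : ∀ {A B} N (F G W : ℕ → ℕ → Carrier) → Support₂ F A → Support₂ G B → A ℕ.+ B ≤ N →
    sumBelow N (λ n → sumBelow N (λ m → (F ⊛₂ G) n m * W n m)) ≈
    sumBelow A (λ i → sumBelow A (λ j → sumBelow B (λ i′ → sumBelow B (λ j′ →
      F i j * G i′ j′ * W (i ℕ.+ i′) (j ℕ.+ j′)))))
  sumBelow-cauchy₂ {A} {B} N F G W suppF suppG A+B≤N = begin
    sumBelow N (λ n → sumBelow N (λ m → (F ⊛₂ G) n m * W n m))
      ≈⟨ sumBelow-cong N (λ n _ → sumBelow-cong N (λ m _ → expand n m)) ⟩
    sumBelow N (λ n → sumBelow N (λ m → sumBelow (suc n) (λ i → sumBelow (suc m) (λ j → Y i (n ∸ i) j (m ∸ j)))))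
      ≈⟨ sumBelow-cong N (λ n _ → sumBelow-comm N (suc n) _) ⟩
    sumBelow N (λ n → sumBelow (suc n) (λ i → sumBelow N (λ m → sumBelow (suc m) (λ j → Y i (n ∸ i) j (m ∸ j)))))
      ≈⟨ sumBelow-cong N (λ n _ → sumBelow-cong (suc n) (λ i _ →
           sumBelow-cauchy N (Y i (n ∸ i)) A+B≤N (λ j j′ A≤j → Y-vanishᶠ (suppF i j (inj₂ A≤j)))
                                                 (λ j j′ B≤j′ → Y-vanishᴳ (suppG (n ∸ i) j′ (inj₂ B≤j′))))) ⟩
    sumBelow N (λ n → sumBelow (suc n) (λ i → Z i (n ∸ i)))
      ≈⟨ sumBelow-cauchy N Z A+B≤N
           (λ i i′ A≤i → sumBelow-zero A (λ j _ → sumBelow-zero B (λ j′ _ → Y-vanishᶠ (suppF i j (inj₁ A≤i)))))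
           (λ i i′ B≤i′ → sumBelow-zero A (λ j _ → sumBelow-zero B (λ j′ _ → Y-vanishᴳ (suppG i′ j′ (inj₁ B≤i′))))) ⟩
    sumBelow A (λ i → sumBelow B (λ i′ → Z i i′))
      ≈⟨ sumBelow-cong A (λ i _ → sumBelow-comm B A _) ⟩
    sumBelow A (λ i → sumBelow A (λ j → sumBelow B (λ i′ → sumBelow B (λ j′ → Y i i′ j j′))))  ∎
    where
      Y : ℕ → ℕ → ℕ → ℕ → Carrier
      Y i i′ j j′ = F i j * G i′ j′ * W (i ℕ.+ i′) (j ℕ.+ j′)
      Z : ℕ → ℕ → Carrier
      Z i i′ = sumBelow A (λ j → sumBelow B (Y i i′ j))

      Y-vanishᶠ : ∀ {i i′ j j′} → F i j ≈ 0# → Y i i′ j j′ ≈ 0#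
      Y-vanishᶠ F≈0 = trans (*-congʳ (trans (*-congʳ F≈0) (zeroˡ _))) (zeroˡ _)
      Y-vanishᴳ : ∀ {i i′ j j′} → G i′ j′ ≈ 0# → Y i i′ j j′ ≈ 0#
      Y-vanishᴳ G≈0 = trans (*-congʳ (trans (*-congˡ G≈0) (zeroʳ _))) (zeroˡ _)

      expand : ∀ n m → (F ⊛₂ G) n m * W n m ≈
                       sumBelow (suc n) (λ i → sumBelow (suc m) (λ j → Y i (n ∸ i) j (m ∸ j)))
      expand n m = begin
        (F ⊛₂ G) n m * W n m
          ≈⟨ *-congʳ (trans (sumTo≈sumBelow n _) (sumBelow-cong (suc n) (λ i _ → sumTo≈sumBelow m _))) ⟩
        sumBelow (suc n) (λ i → sumBelow (suc m) (λ j → F i j * G (n ∸ i) (m ∸ j))) * W n m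
          ≈⟨ trans (*-distribʳ-sumBelow (suc n) _ _) (sumBelow-cong (suc n) (λ i _ → *-distribʳ-sumBelow (suc m) _ _)) ⟩
        sumBelow (suc n) (λ i → sumBelow (suc m) (λ j → F i j * G (n ∸ i) (m ∸ j) * W n m))
          ≈⟨ sumBelow-cong (suc n) (λ i i≤n → sumBelow-cong (suc m) (λ j j≤m → *-congˡ (reflexive
               (≡.sym (≡.cong₂ W (ℕP.m+[n∸m]≡n (ℕP.≤-pred i≤n)) (ℕP.m+[n∸m]≡n (ℕP.≤-pred j≤m))))))) ⟩
        sumBelow (suc n) (λ i → sumBelow (suc m) (λ j → Y i (n ∸ i) j (m ∸ j)))  ∎

  *-distrib-sumBelow₂ : ∀ A A′ B B′ (f g : ℕ → ℕ → Carrier) →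
    sumBelow A (λ i → sumBelow A′ (f i)) * sumBelow B (λ i′ → sumBelow B′ (g i′)) ≈
    sumBelow A (λ i → sumBelow A′ (λ j → sumBelow B (λ i′ → sumBelow B′ (λ j′ → f i j * g i′ j′))))
  *-distrib-sumBelow₂ A A′ B B′ f g = begin
    sumBelow A (λ i → sumBelow A′ (f i)) * G
      ≈⟨ *-distribʳ-sumBelow A G _ ⟩
    sumBelow A (λ i → sumBelow A′ (f i) * G)
      ≈⟨ sumBelow-cong A (λ i _ → *-distribʳ-sumBelow A′ G (f i)) ⟩
    sumBelow A (λ i → sumBelow A′ (λ j → f i j * G))
      ≈⟨ sumBelow-cong A (λ i _ → sumBelow-cong A′ (λ j _ → trans (*-distribˡ-sumBelow B (f i j) _)
           (sumBelow-cong B (λ i′ _ → *-distribˡ-sumBelow B′ (f i j) (g i′))))) ⟩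
    sumBelow A (λ i → sumBelow A′ (λ j → sumBelow B (λ i′ → sumBelow B′ (λ j′ → f i j * g i′ j′))))  ∎
    where G = sumBelow B (λ i′ → sumBelow B′ (g i′))

module PowerSeries {c ℓ} (R : CommutativeRing c ℓ) where
  open CommutativeRing R
  open Poly R
  open Sums R
  open import Relation.Binary.Reasoning.Setoid setoid
  open import Algebra.Properties.Ring ring using (-1*x≈-x)

  coeff-⊛ : ∀ f g n → (f ⊛ g) n ≈ sumBelow (suc n) (λ k → f k * g (n ∸ k))
  coeff-⊛ f g n = sumTo≈sumBelow n _

  ⊛-cong : ∀ {f f′ g g′} → f ≋ f′ → g ≋ g′ → (f ⊛ g) ≋ (f′ ⊛ g′)
  ⊛-cong {f} {f′} {g} {g′} f≋f′ g≋g′ n = begin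
    (f ⊛ g) n                               ≈⟨ coeff-⊛ f g n ⟩
    sumBelow (suc n) (λ k → f k * g (n ∸ k))   ≈⟨ sumBelow-cong (suc n) (λ k _ → *-cong (f≋f′ k) (g≋g′ (n ∸ k))) ⟩
    sumBelow (suc n) (λ k → f′ k * g′ (n ∸ k)) ≈⟨ coeff-⊛ f′ g′ n ⟨
    (f′ ⊛ g′) n                             ∎

  ⊛-comm : ∀ f g → (f ⊛ g) ≋ (g ⊛ f)
  ⊛-comm f g n = begin
    (f ⊛ g) n                                         ≈⟨ coeff-⊛ f g n ⟩
    sumBelow (suc n) (λ k → f k * g (n ∸ k))             ≈⟨ sumBelow-reverse (suc n) _ ⟨
    sumBelow (suc n) (λ k → f (n ∸ k) * g (n ∸ (n ∸ k))) ≈⟨ sumBelow-cong (suc n) (λ k k≤n →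
                                                           trans (*-comm _ _) (*-congʳ (reflexive
                                                             (≡.cong g (ℕP.m∸[m∸n]≡n (ℕP.≤-pred k≤n)))))) ⟩
    sumBelow (suc n) (λ k → g k * f (n ∸ k))             ≈⟨ coeff-⊛ g f n ⟨
    (g ⊛ f) n                                         ∎

  ⊛-assoc : ∀ f g h → ((f ⊛ g) ⊛ h) ≋ (f ⊛ (g ⊛ h))
  ⊛-assoc f g h n = begin
    ((f ⊛ g) ⊛ h) n
      ≈⟨ coeff-⊛ (f ⊛ g) h n ⟩
    sumBelow (suc n) (λ k → (f ⊛ g) k * h (n ∸ k))
      ≈⟨ sumBelow-cong (suc n) (λ k _ → trans (*-congʳ (coeff-⊛ f g k)) (*-distribʳ-sumBelow (suc k) _ _)) ⟩
    sumBelow (suc n) (λ k → sumBelow (suc k) (λ a → f a * g (k ∸ a) * h (n ∸ k)))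
      ≈⟨ sumBelow-cong (suc n) (λ k _ → sumBelow-cong (suc k) (λ a a≤k → *-congˡ (reflexive
           (≡.cong (λ t → h (n ∸ t)) (≡.sym (ℕP.m+[n∸m]≡n (ℕP.≤-pred a≤k))))))) ⟩
    sumBelow (suc n) (λ k → sumBelow (suc k) (λ a → G a (k ∸ a)))
      ≈⟨ sumBelow-antidiagonals (suc n) G ⟩
    sumBelow (suc n) (λ a → sumBelow (suc n ∸ a) (G a))
      ≈⟨ sumBelow-cong (suc n) (λ a a≤n → row a (ℕP.≤-pred a≤n)) ⟩
    sumBelow (suc n) (λ a → f a * (g ⊛ h) (n ∸ a))
      ≈⟨ coeff-⊛ f (g ⊛ h) n ⟨
    (f ⊛ (g ⊛ h)) n  ∎
    where
      G : ℕ → ℕ → Carrier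
      G a b = f a * g b * h (n ∸ (a ℕ.+ b))
      row : ∀ a → a ≤ n → sumBelow (suc n ∸ a) (G a) ≈ f a * (g ⊛ h) (n ∸ a)
      row a a≤n = begin
        sumBelow (suc n ∸ a) (G a)
          ≡⟨ ≡.cong (λ t → sumBelow t (G a)) (ℕP.+-∸-assoc 1 a≤n) ⟩
        sumBelow (suc (n ∸ a)) (G a)
          ≈⟨ sumBelow-cong (suc (n ∸ a)) (λ b _ → trans (*-assoc _ _ _) (*-congˡ (*-congˡ (reflexive
               (≡.cong h (≡.sym (ℕP.∸-+-assoc n a b))))))) ⟩
        sumBelow (suc (n ∸ a)) (λ b → f a * (g b * h ((n ∸ a) ∸ b)))
          ≈⟨ *-distribˡ-sumBelow (suc (n ∸ a)) (f a) _ ⟨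
        f a * sumBelow (suc (n ∸ a)) (λ b → g b * h ((n ∸ a) ∸ b))
          ≈⟨ *-congˡ (coeff-⊛ g h (n ∸ a)) ⟨
        f a * (g ⊛ h) (n ∸ a)  ∎

  ⊛-distribˡ-⊕ : ∀ f g h → (f ⊛ (g ⊕ h)) ≋ ((f ⊛ g) ⊕ (f ⊛ h))
  ⊛-distribˡ-⊕ f g h n = begin
    (f ⊛ (g ⊕ h)) n
      ≈⟨ coeff-⊛ f (g ⊕ h) n ⟩
    sumBelow (suc n) (λ k → f k * (g (n ∸ k) + h (n ∸ k)))
      ≈⟨ sumBelow-cong (suc n) (λ k _ → distribˡ _ _ _) ⟩
    sumBelow (suc n) (λ k → f k * g (n ∸ k) + f k * h (n ∸ k))
      ≈⟨ sumBelow-distrib-+ (suc n) _ _ ⟩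
    sumBelow (suc n) (λ k → f k * g (n ∸ k)) + sumBelow (suc n) (λ k → f k * h (n ∸ k))
      ≈⟨ +-cong (coeff-⊛ f g n) (coeff-⊛ f h n) ⟨
    ((f ⊛ g) ⊕ (f ⊛ h)) n  ∎

  coeff-cst-⊛ : ∀ a f n → (cst a ⊛ f) n ≈ a * f n
  coeff-cst-⊛ a f n = begin
    (cst a ⊛ f) n                                 ≈⟨ coeff-⊛ (cst a) f n ⟩
    sumBelow (suc n) (λ k → cst a k * f (n ∸ k))  ≈⟨ sumBelow-suc n _ ⟩
    a * f n + sumBelow n (λ k → 0# * f (n ∸ suc k)) ≈⟨ +-congˡ (sumBelow-zero n (λ k _ → zeroˡ _)) ⟩
    a * f n + 0#                                  ≈⟨ +-identityʳ _ ⟩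
    a * f n                                       ∎

  ⊛-identityˡ : ∀ f → (cst 1# ⊛ f) ≋ f
  ⊛-identityˡ f n = trans (coeff-cst-⊛ 1# f n) (*-identityˡ _)

  𝟘 : Seq
  𝟘 _ = 0#

  negate : Seq → Seq
  negate f k = - f k

  powerSeries : CommutativeRing c ℓ
  powerSeries = record
    { _≈_ = _≋_ ; _+_ = _⊕_ ; _*_ = _⊛_ ; -_ = negate ; 0# = 𝟘 ; 1# = cst 1#
    ; isCommutativeRing = record
      { isRing = record
        { +-isAbelianGroup = Pointwise.isAbelianGroup ℕ +-isAbelianGroup
        ; *-cong           = ⊛-cong
        ; *-assoc          = ⊛-assoc
        ; *-identity       = ⊛-identityˡ , λ f n → trans (⊛-comm f (cst 1#) n) (⊛-identityˡ f n)
        ; distrib          = ⊛-distribˡ-⊕ , λ f g h n →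
                               trans (⊛-comm (g ⊕ h) f n)
                                     (trans (⊛-distribˡ-⊕ f g h n) (+-cong (⊛-comm f g n) (⊛-comm f h n)))
        }
      ; *-comm = ⊛-comm
      }
    }
    where import Algebra.Construct.Pointwise as Pointwise

  module S = CommutativeRing powerSeries
  module ≋-Reasoning = Relation.Binary.Reasoning.Setoid S.setoid
  module Σˢ = Sums powerSeries
  open Poly powerSeries public using () renaming (sumBelow to sumBelowˢ)

  coeff-sumBelowˢ : ∀ n F k → sumBelowˢ n F k ≡ sumBelow n (λ i → F i k)
  coeff-sumBelowˢ zero    F k = ≡.refl
  coeff-sumBelowˢ (suc n) F k = ≡.cong (_+ F n k) (coeff-sumBelowˢ n F k)

  sumSeq≋sumBelowˢ : ∀ n F → sumSeq n F ≋ sumBelowˢ n F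
  sumSeq≋sumBelowˢ n F k = reflexive (≡.sym (coeff-sumBelowˢ n F k))

  cst-cong : ∀ {a b} → a ≈ b → cst a ≋ cst b
  cst-cong a≈b zero    = a≈b
  cst-cong a≈b (suc k) = refl

  cst-0 : cst 0# ≋ 𝟘
  cst-0 zero    = refl
  cst-0 (suc k) = refl

  cst-+ : ∀ a b → cst (a + b) ≋ (cst a ⊕ cst b)
  cst-+ a b zero    = refl
  cst-+ a b (suc k) = sym (+-identityˡ 0#)

  cst-* : ∀ a b → cst (a * b) ≋ (cst a ⊛ cst b)
  cst-* a b zero    = sym (coeff-cst-⊛ a (cst b) 0)
  cst-* a b (suc k) = sym (trans (coeff-cst-⊛ a (cst b) (suc k)) (zeroʳ a))

  cst-sumBelow : ∀ n f → cst (sumBelow n f) ≋ sumBelowˢ n (cst ∘ f)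
  cst-sumBelow zero    f = cst-0
  cst-sumBelow (suc n) f = S.trans (cst-+ (sumBelow n f) (f n)) (S.+-congʳ (cst-sumBelow n f))

  coeff-X⊛-zero : ∀ f → (X ⊛ f) 0 ≈ 0#
  coeff-X⊛-zero f = zeroˡ _

  coeff-X⊛-suc : ∀ f k → (X ⊛ f) (suc k) ≈ f k
  coeff-X⊛-suc f k = begin
    (X ⊛ f) (suc k)                                       ≈⟨ coeff-⊛ X f (suc k) ⟩
    sumBelow (suc (suc k)) (λ i → X i * f (suc k ∸ i))  ≈⟨ sumBelow-single (suc (suc k)) 1 (s≤s (s≤s z≤n)) offDiagonal ⟩
    1# * f k                                              ≈⟨ *-identityˡ _ ⟩
    f k                                                   ∎
    where
      offDiagonal : ∀ i → i < suc (suc k) → i ≢ 1 → X i * f (suc k ∸ i) ≈ 0#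
      offDiagonal zero          _ _   = zeroˡ _
      offDiagonal (suc zero)    _ i≢1 = contradiction ≡.refl i≢1
      offDiagonal (suc (suc i)) _ _   = zeroˡ _

  coeff-X-1⊛-zero : ∀ f → (X-1 ⊛ f) 0 ≈ - f 0
  coeff-X-1⊛-zero f = begin
    (X-1 ⊛ f) 0                       ≈⟨ S.distribʳ f X (cst (- 1#)) 0 ⟩
    (X ⊛ f) 0 + (cst (- 1#) ⊛ f) 0    ≈⟨ +-cong (coeff-X⊛-zero f) (coeff-cst-⊛ (- 1#) f 0) ⟩
    0# + - 1# * f 0                   ≈⟨ trans (+-identityˡ _) (-1*x≈-x _) ⟩
    - f 0                             ∎

  coeff-X-1⊛-suc : ∀ f k → (X-1 ⊛ f) (suc k) ≈ f k - f (suc k)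
  coeff-X-1⊛-suc f k = begin
    (X-1 ⊛ f) (suc k)                           ≈⟨ S.distribʳ f X (cst (- 1#)) (suc k) ⟩
    (X ⊛ f) (suc k) + (cst (- 1#) ⊛ f) (suc k)  ≈⟨ +-cong (coeff-X⊛-suc f k) (coeff-cst-⊛ (- 1#) f (suc k)) ⟩
    f k + - 1# * f (suc k)                      ≈⟨ +-congˡ (-1*x≈-x _) ⟩
    f k - f (suc k)                             ∎

  ^ˢ-+ : ∀ f a b → (f ^ˢ (a ℕ.+ b)) ≋ ((f ^ˢ a) ⊛ (f ^ˢ b))
  ^ˢ-+ f zero    b = S.sym (⊛-identityˡ _)
  ^ˢ-+ f (suc a) b = S.trans (⊛-cong S.refl (^ˢ-+ f a b)) (S.sym (⊛-assoc f (f ^ˢ a) (f ^ˢ b)))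

module Polynomials {c ℓ} (R : CommutativeRing c ℓ) where
  open CommutativeRing R
  open Poly R
  open Sums R
  open PowerSeries R
  open import Relation.Binary.Reasoning.Setoid setoid
  open import Algebra.Properties.Ring ring using (-‿involutive; -0#≈0#)

  DegBelow : Seq → ℕ → Set ℓ
  DegBelow f b = ∀ k → b ≤ k → f k ≈ 0#

  DegBelow-mono : ∀ {f a b} → a ≤ b → DegBelow f a → DegBelow f b
  DegBelow-mono a≤b f<a k b≤k = f<a k (ℕP.≤-trans a≤b b≤k)

  DegBelow-lower : ∀ {f b} → DegBelow f (suc b) → f b ≈ 0# → DegBelow f b
  DegBelow-lower f≤b fb≈0 k b≤k with ℕP.m≤n⇒m<n∨m≡n b≤k
  ... | inj₁ b<k    = f≤b k b<k
  ... | inj₂ ≡.refl = fb≈0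

  DegBelow-⊕ : ∀ {f g b} → DegBelow f b → DegBelow g b → DegBelow (f ⊕ g) b
  DegBelow-⊕ f<b g<b k b≤k = trans (+-cong (f<b k b≤k) (g<b k b≤k)) (+-identityˡ 0#)

  DegBelow-cst : ∀ a → DegBelow (cst a) 1
  DegBelow-cst a (suc k) _ = refl

  cst⊛-vanishes : ∀ {a} f → a ≈ 0# → (cst a ⊛ f) ≋ 𝟘
  cst⊛-vanishes {a} f a≈0 k = trans (coeff-cst-⊛ a f k) (trans (*-congʳ a≈0) (zeroˡ _))

  DegBelow-cst⊛ : ∀ {g b} a → DegBelow g b → DegBelow (cst a ⊛ g) b
  DegBelow-cst⊛ {g} a g<b k b≤k = trans (coeff-cst-⊛ a g k) (trans (*-congˡ (g<b k b≤k)) (zeroʳ a))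

  -- Phrased with k ∸ a so that b = 0 (that is, g ≋ 0) makes every coefficient vanish, not only those beyond a.
  ⊛-vanishes : ∀ {f g a b} → DegBelow f (suc a) → DegBelow g b → ∀ k → b ≤ k ∸ a → (f ⊛ g) k ≈ 0#
  ⊛-vanishes {f} {g} {a} f≤a g<b k b≤k∸a = trans (coeff-⊛ f g k) (sumBelow-zero (suc k) term)
    where
      term : ∀ i → i < suc k → f i * g (k ∸ i) ≈ 0#
      term i _ with a ℕP.<? i
      ... | yes a<i = trans (*-congʳ (f≤a i a<i)) (zeroˡ _)
      ... | no  a≮i = trans (*-congˡ (g<b (k ∸ i) (ℕP.≤-trans b≤k∸a (ℕP.∸-monoʳ-≤ k (ℕP.≮⇒≥ a≮i))))) (zeroʳ _)

  DegBelow-⊛ : ∀ {f g a b} → DegBelow f (suc a) → DegBelow g b → DegBelow (f ⊛ g) (a ℕ.+ b)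
  DegBelow-⊛ {a = a} {b} f≤a g<b k a+b≤k =
    ⊛-vanishes f≤a g<b k (ℕP.m+n≤o⇒m≤o∸n b (ℕP.≤-trans (ℕP.≤-reflexive (ℕP.+-comm b a)) a+b≤k))

  coeff-⊛-top : ∀ {f g} a b → DegBelow f (suc a) → DegBelow g (suc b) → (f ⊛ g) (a ℕ.+ b) ≈ f a * g b
  coeff-⊛-top {f} {g} a b f≤a g≤b = begin
    (f ⊛ g) (a ℕ.+ b)                                        ≈⟨ coeff-⊛ f g (a ℕ.+ b) ⟩
    sumBelow (suc (a ℕ.+ b)) (λ i → f i * g (a ℕ.+ b ∸ i))  ≈⟨ sumBelow-single _ a (s≤s (ℕP.m≤m+n a b)) offTop ⟩
    f a * g (a ℕ.+ b ∸ a)                                    ≡⟨ ≡.cong (λ t → f a * g t) (ℕP.m+n∸m≡n a b) ⟩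
    f a * g b                                                ∎
    where
      offTop : ∀ i → i < suc (a ℕ.+ b) → i ≢ a → f i * g (a ℕ.+ b ∸ i) ≈ 0#
      offTop i _ i≢a with a ℕP.<? i
      ... | yes a<i = trans (*-congʳ (f≤a i a<i)) (zeroˡ _)
      ... | no  a≮i = trans (*-congˡ (g≤b _ b<a+b∸i)) (zeroʳ _)
        where
          b<a+b∸i : suc b ≤ a ℕ.+ b ∸ i
          b<a+b∸i = ℕP.m+n≤o⇒m≤o∸n (suc b) (ℕP.≤-trans (ℕP.≤-reflexive (≡.cong suc (ℕP.+-comm b i)))
                                      (ℕP.+-monoˡ-≤ b (ℕP.≤∧≢⇒< (ℕP.≮⇒≥ a≮i) i≢a)))

  IsPoly-⊕ : ∀ {f g} → IsPoly f → IsPoly g → IsPoly (f ⊕ g)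
  IsPoly-⊕ (a , f<a) (b , g<b) =
    a ℕ.+ b , DegBelow-⊕ (DegBelow-mono (ℕP.m≤m+n a b) f<a) (DegBelow-mono (ℕP.m≤n+m b a) g<b)

  IsPoly-⊛ : ∀ {f g} → IsPoly f → IsPoly g → IsPoly (f ⊛ g)
  IsPoly-⊛ (a , f<a) (b , g<b) = a ℕ.+ b , DegBelow-⊛ (DegBelow-mono (ℕP.n≤1+n a) f<a) g<b

  IsPoly-sumSeq : ∀ n F → (∀ i → i < n → IsPoly (F i)) → IsPoly (sumSeq n F)
  IsPoly-sumSeq zero    F _      = 0 , λ _ _ → refl
  IsPoly-sumSeq (suc n) F F-poly =
    IsPoly-⊕ (IsPoly-sumSeq n F (λ i i<n → F-poly i (ℕP.m<n⇒m<1+n i<n))) (F-poly n (ℕP.n<1+n n))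

  Monic : Seq → ℕ → Set ℓ
  Monic f a = DegBelow f (suc a) × f a ≈ 1#

  Monic-⊛ : ∀ {f g a b} → Monic f a → Monic g b → Monic (f ⊛ g) (a ℕ.+ b)
  Monic-⊛ {a = a} {b} (f≤a , fa≈1) (g≤b , gb≈1) =
    DegBelow-mono (ℕP.≤-reflexive (ℕP.+-suc a b)) (DegBelow-⊛ f≤a g≤b) ,
    trans (coeff-⊛-top a b f≤a g≤b) (trans (*-cong fa≈1 gb≈1) (*-identityˡ 1#))

  Monic-^ˢ : ∀ {f a} k → Monic f a → Monic (f ^ˢ k) (k ℕ.* a)
  Monic-^ˢ zero    _       = DegBelow-cst 1# , refl
  Monic-^ˢ (suc k) f-monic = Monic-⊛ f-monic (Monic-^ˢ k f-monic)

  Monic-X : Monic X 1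
  Monic-X = (λ { (suc (suc k)) _ → refl ; (suc zero) (s≤s ()) }) , refl

  Monic-X-1 : Monic X-1 1
  Monic-X-1 = (λ { (suc (suc k)) _ → +-identityˡ 0# ; (suc zero) (s≤s ()) }) , +-identityʳ 1#

  Monic-^ˢ-linear : ∀ {f} k → Monic f 1 → Monic (f ^ˢ k) k
  Monic-^ˢ-linear {f} k f-monic = ≡.subst (Monic (f ^ˢ k)) (ℕP.*-identityʳ k) (Monic-^ˢ k f-monic)

  IsPoly-X-1ᵏ : ∀ k → IsPoly (X-1 ^ˢ k)
  IsPoly-X-1ᵏ k = suc k , proj₁ (Monic-^ˢ-linear k Monic-X-1)

  coeff-Xⁿ-≢ : ∀ n k → k ≢ n → (X ^ˢ n) k ≈ 0#
  coeff-Xⁿ-≢ n k k≢n with k ℕP.<? n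
  ... | no  k≮n = proj₁ (Monic-^ˢ-linear n Monic-X) k (ℕP.≤∧≢⇒< (ℕP.≮⇒≥ k≮n) (k≢n ∘ ≡.sym))
  ... | yes k<n = below n k k<n
    where
      below : ∀ n k → k < n → (X ^ˢ n) k ≈ 0#
      below (suc n) zero    _         = coeff-X⊛-zero (X ^ˢ n)
      below (suc n) (suc k) (s≤s k<n) = trans (coeff-X⊛-suc (X ^ˢ n) k) (below n k k<n)

  monomial-expansion : ∀ {N f} → DegBelow f (suc N) → sumBelowˢ (suc N) (λ i → cst (f i) ⊛ (X ^ˢ i)) ≋ f
  monomial-expansion {N} {f} f≤N k = begin
    sumBelowˢ (suc N) (λ i → cst (f i) ⊛ (X ^ˢ i)) k  ≡⟨ coeff-sumBelowˢ (suc N) _ k ⟩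
    sumBelow (suc N) (λ i → (cst (f i) ⊛ (X ^ˢ i)) k)  ≈⟨ sumBelow-cong (suc N) (λ i _ → coeff-cst-⊛ (f i) (X ^ˢ i) k) ⟩
    sumBelow (suc N) (λ i → f i * (X ^ˢ i) k)          ≈⟨ coefficient ⟩
    f k                                                ∎
    where
      off : ∀ i → i ≢ k → f i * (X ^ˢ i) k ≈ 0#
      off i i≢k = trans (*-congˡ (coeff-Xⁿ-≢ i k (i≢k ∘ ≡.sym))) (zeroʳ _)
      coefficient : sumBelow (suc N) (λ i → f i * (X ^ˢ i) k) ≈ f k
      coefficient with k ℕP.≤? N
      ... | yes k≤N = trans (sumBelow-single (suc N) k (s≤s k≤N) (λ i _ → off i))
                            (trans (*-congˡ (proj₂ (Monic-^ˢ-linear k Monic-X))) (*-identityʳ _))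
      ... | no  k≰N = trans (sumBelow-zero (suc N) (λ i i≤N → off i (λ { ≡.refl → k≰N (ℕP.≤-pred i≤N) })))
                            (sym (f≤N k (ℕP.≰⇒> k≰N)))

  X⊛-cancel : ∀ {f g} → (X ⊛ f) ≋ (X ⊛ g) → f ≋ g
  X⊛-cancel {f} {g} Xf≋Xg k = trans (sym (coeff-X⊛-suc f k)) (trans (Xf≋Xg (suc k)) (coeff-X⊛-suc g k))

  X-1⊛-cancel : ∀ {f g} → (X-1 ⊛ f) ≋ (X-1 ⊛ g) → f ≋ g
  X-1⊛-cancel {f} {g} eq zero    = ⁻¹-injective (trans (sym (coeff-X-1⊛-zero f)) (trans (eq 0) (coeff-X-1⊛-zero g)))
    where open import Algebra.Properties.Group +-group using (⁻¹-injective)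
  X-1⊛-cancel {f} {g} eq (suc k) = ⁻¹-injective (∙-cancelˡ (f k) _ _ (begin
    f k - f (suc k)      ≈⟨ coeff-X-1⊛-suc f k ⟨
    (X-1 ⊛ f) (suc k)    ≈⟨ eq (suc k) ⟩
    (X-1 ⊛ g) (suc k)    ≈⟨ coeff-X-1⊛-suc g k ⟩
    g k - g (suc k)      ≈⟨ +-congʳ (X-1⊛-cancel {f} {g} eq k) ⟨
    f k - g (suc k)      ∎))
    where open import Algebra.Properties.Group +-group using (⁻¹-injective; ∙-cancelˡ)

  X-1ᵐ⊛-cancel : ∀ m {f g} → ((X-1 ^ˢ m) ⊛ f) ≋ ((X-1 ^ˢ m) ⊛ g) → f ≋ g
  X-1ᵐ⊛-cancel zero    {f} {g} eq = S.trans (S.sym (⊛-identityˡ f)) (S.trans eq (⊛-identityˡ g))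
  X-1ᵐ⊛-cancel (suc m) {f} {g} eq =
    X-1ᵐ⊛-cancel m (X-1⊛-cancel (S.trans (S.sym (S.*-assoc X-1 _ f)) (S.trans eq (S.*-assoc X-1 _ g))))

  shift : Seq → Seq
  shift f k = f (suc k)

  X⊛shift : ∀ {f} → f 0 ≈ 0# → f ≋ (X ⊛ shift f)
  X⊛shift {f} f0≈0 zero    = trans f0≈0 (sym (coeff-X⊛-zero (shift f)))
  X⊛shift {f} f0≈0 (suc k) = sym (coeff-X⊛-suc (shift f) k)

  DegBelow-shift : ∀ {f b} → DegBelow f b → DegBelow (shift f) b
  DegBelow-shift f<b k b≤k = f<b (suc k) (ℕP.m≤n⇒m≤1+n b≤k)

  sumBelow-X-1⊛ : ∀ Q N → sumBelow (suc N) (X-1 ⊛ Q) ≈ - Q N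
  sumBelow-X-1⊛ Q zero    = trans (+-identityˡ _) (coeff-X-1⊛-zero Q)
  sumBelow-X-1⊛ Q (suc N) = begin
    sumBelow (suc N) (X-1 ⊛ Q) + (X-1 ⊛ Q) (suc N)  ≈⟨ +-cong (sumBelow-X-1⊛ Q N) (coeff-X-1⊛-suc Q N) ⟩
    - Q N + (Q N - Q (suc N))                     ≈⟨ +-assoc _ _ _ ⟨
    (- Q N + Q N) - Q (suc N)                     ≈⟨ +-congʳ (-‿inverseˡ (Q N)) ⟩
    0# - Q (suc N)                                ≈⟨ +-identityˡ _ ⟩
    - Q (suc N)                                   ∎

  sumBelow-X-1⊛-vanishes : ∀ {Q q} → DegBelow Q q → ∀ N → q < N → sumBelow N (X-1 ⊛ Q) ≈ 0#
  sumBelow-X-1⊛-vanishes {Q} Q<q (suc N) q≤N = begin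
    sumBelow (suc N) (X-1 ⊛ Q)  ≈⟨ sumBelow-X-1⊛ Q N ⟩
    - Q N                       ≈⟨ -‿cong (Q<q N (ℕP.≤-pred q≤N)) ⟩
    - 0#                        ≈⟨ -0#≈0# ⟩
    0#                          ∎

  sumBelow-⊛ : ∀ {f g a b} → DegBelow f a → DegBelow g b →
               sumBelow (a ℕ.+ b) (f ⊛ g) ≈ sumBelow a f * sumBelow b g
  sumBelow-⊛ {f} {g} {a} {b} f<a g<b = begin
    sumBelow (a ℕ.+ b) (f ⊛ g)
      ≈⟨ sumBelow-cong (a ℕ.+ b) (λ k _ → coeff-⊛ f g k) ⟩
    sumBelow (a ℕ.+ b) (λ k → sumBelow (suc k) (λ i → f i * g (k ∸ i)))
      ≈⟨ sumBelow-cauchy (a ℕ.+ b) (λ i j → f i * g j) ℕP.≤-refl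
           (λ i j a≤i → trans (*-congʳ (f<a i a≤i)) (zeroˡ _)) (λ i j b≤j → trans (*-congˡ (g<b j b≤j)) (zeroʳ _)) ⟩
    sumBelow a (λ i → sumBelow b (λ j → f i * g j))
      ≈⟨ sumBelow-cong a (λ i _ → *-distribˡ-sumBelow b (f i) g) ⟨
    sumBelow a (λ i → f i * sumBelow b g)
      ≈⟨ *-distribʳ-sumBelow a (sumBelow b g) f ⟨
    sumBelow a f * sumBelow b g  ∎

  -- Every power series is (X - 1) times its negated partial sums, since 1 - X is a unit;
  -- the cofactor is a polynomial exactly when the value at 1 vanishes.
  negPartialSums : Seq → Seq
  negPartialSums f k = - sumBelow (suc k) f

  X-1⊛negPartialSums : ∀ f → (X-1 ⊛ negPartialSums f) ≋ f
  X-1⊛negPartialSums f zero    = begin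
    (X-1 ⊛ negPartialSums f) 0  ≈⟨ coeff-X-1⊛-zero (negPartialSums f) ⟩
    - - (0# + f 0)              ≈⟨ -‿involutive _ ⟩
    0# + f 0                    ≈⟨ +-identityˡ _ ⟩
    f 0                         ∎
  X-1⊛negPartialSums f (suc k) = begin
    (X-1 ⊛ negPartialSums f) (suc k)             ≈⟨ coeff-X-1⊛-suc (negPartialSums f) k ⟩
    - sumBelow (suc k) f - - (sumBelow (suc k) f + f (suc k))  ≈⟨ +-congˡ (-‿involutive _) ⟩
    - sumBelow (suc k) f + (sumBelow (suc k) f + f (suc k))    ≈⟨ +-assoc _ _ _ ⟨
    (- sumBelow (suc k) f + sumBelow (suc k) f) + f (suc k)    ≈⟨ +-congʳ (-‿inverseˡ _) ⟩
    0# + f (suc k)                                               ≈⟨ +-identityˡ _ ⟩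
    f (suc k)                                                    ∎

  DegBelow-negPartialSums : ∀ {f b} → DegBelow f b → sumBelow b f ≈ 0# → DegBelow (negPartialSums f) b
  DegBelow-negPartialSums {f} {b} f<b f[1]≈0 k b≤k = begin
    - sumBelow (suc k) f  ≈⟨ -‿cong (sumBelow-extend (suc k) (ℕP.m≤n⇒m≤1+n b≤k) (λ i b≤i _ → f<b i b≤i)) ⟩
    - sumBelow b f        ≈⟨ -‿cong f[1]≈0 ⟩
    - 0#                  ≈⟨ -0#≈0# ⟩
    0#                    ∎

  infix 4 _∣_
  _∣_ : Seq → Seq → Set (c ⊔ ℓ)
  A ∣ P = ∃[ H ] (IsPoly H × (A ⊛ H) ≋ P)

  ∣-respʳ : ∀ {A P Q} → P ≋ Q → A ∣ P → A ∣ Q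
  ∣-respʳ P≋Q (H , H-poly , AH≋P) = H , H-poly , S.trans AH≋P P≋Q

  special : Carrier → ℕ → ℕ → Seq
  special a k l = cst a ⊛ ((X-1 ^ˢ k) ⊛ (X ^ˢ l))

  DegBelow-special : ∀ a k l → DegBelow (special a k l) (suc (k ℕ.+ l))
  DegBelow-special a k l =
    DegBelow-cst⊛ a (proj₁ (Monic-⊛ (Monic-^ˢ-linear k Monic-X-1) (Monic-^ˢ-linear l Monic-X)))

  coeff-special-top : ∀ a k l → special a k l (k ℕ.+ l) ≈ a
  coeff-special-top a k l =
    trans (coeff-cst-⊛ a ((X-1 ^ˢ k) ⊛ (X ^ˢ l)) (k ℕ.+ l))
          (trans (*-congˡ (proj₂ (Monic-⊛ (Monic-^ˢ-linear k Monic-X-1) (Monic-^ˢ-linear l Monic-X))))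
                 (*-identityʳ a))

  IsPoly-special : ∀ a k l → IsPoly (special a k l)
  IsPoly-special a k l = suc (k ℕ.+ l) , DegBelow-special a k l

  special-suc-X : ∀ a k l → special a k (suc l) ≋ (X ⊛ special a k l)
  special-suc-X a k l =
    S.sym (S.trans (x∙yz≈y∙xz X (cst a) ((X-1 ^ˢ k) ⊛ (X ^ˢ l))) (S.*-congˡ (x∙yz≈y∙xz X (X-1 ^ˢ k) (X ^ˢ l))))
    where open import Algebra.Properties.CommutativeSemigroup S.*-commutativeSemigroup using (x∙yz≈y∙xz)

  special-suc-X-1 : ∀ a k l → special a (suc k) l ≋ (X-1 ⊛ special a k l)
  special-suc-X-1 a k l =
    S.trans (S.*-congˡ (S.*-assoc X-1 (X-1 ^ˢ k) (X ^ˢ l))) (x∙yz≈y∙xz (cst a) X-1 ((X-1 ^ˢ k) ⊛ (X ^ˢ l)))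
    where open import Algebra.Properties.CommutativeSemigroup S.*-commutativeSemigroup using (x∙yz≈y∙xz)

  special-zero : ∀ a → special a 0 0 ≋ cst a
  special-zero a = S.trans (S.*-congˡ (S.*-identityˡ (cst 1#))) (S.*-identityʳ (cst a))

  X-1ᵉ⊛special : ∀ e a k l → ((X-1 ^ˢ e) ⊛ special a k l) ≋ special a (e ℕ.+ k) l
  X-1ᵉ⊛special e a k l =
    S.trans (x∙yz≈y∙xz (X-1 ^ˢ e) (cst a) ((X-1 ^ˢ k) ⊛ (X ^ˢ l)))
            (S.*-congˡ {cst a} (S.trans (S.sym (S.*-assoc (X-1 ^ˢ e) (X-1 ^ˢ k) (X ^ˢ l)))
                                        (S.*-congʳ {X ^ˢ l} (S.sym (^ˢ-+ X-1 e k)))))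
    where open import Algebra.Properties.CommutativeSemigroup S.*-commutativeSemigroup using (x∙yz≈y∙xz)

  X-1∣κXⁿ⇒κ≈0 : ∀ {Q κ n} → IsPoly Q → (X-1 ⊛ Q) ≋ (cst κ ⊛ (X ^ˢ n)) → κ ≈ 0#
  X-1∣κXⁿ⇒κ≈0 {Q} {κ} {n} (q , Q<q) X-1Q≋κXⁿ = begin
    κ                              ≈⟨ *-identityʳ κ ⟨
    κ * 1#                         ≈⟨ *-congˡ (proj₂ (Monic-^ˢ-linear n Monic-X)) ⟨
    κ * (X ^ˢ n) n                 ≈⟨ coeff-cst-⊛ κ (X ^ˢ n) n ⟨
    (cst κ ⊛ (X ^ˢ n)) n           ≈⟨ sumBelow-single N n (s≤s (ℕP.m≤m+n n q)) off ⟨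
    sumBelow N (cst κ ⊛ (X ^ˢ n))  ≈⟨ sumBelow-cong N (λ k _ → X-1Q≋κXⁿ k) ⟨
    sumBelow N (X-1 ⊛ Q)           ≈⟨ sumBelow-X-1⊛-vanishes Q<q N (s≤s (ℕP.m≤n+m q n)) ⟩
    0#                             ∎
    where
      N = suc (n ℕ.+ q)
      off : ∀ i → i < N → i ≢ n → (cst κ ⊛ (X ^ˢ n)) i ≈ 0#
      off i _ i≢n = trans (coeff-cst-⊛ κ (X ^ˢ n) i) (trans (*-congˡ (coeff-Xⁿ-≢ n i i≢n)) (zeroʳ κ))

  SpecialForm-cong : ∀ {f g} → f ≋ g → SpecialForm f → SpecialForm g
  SpecialForm-cong f≋g (a , k , l , a≉0 , f≋special) = a , k , l , a≉0 , S.trans (S.sym f≋g) f≋special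

  SpecialForm-X⊛ : ∀ {f} → SpecialForm f → SpecialForm (X ⊛ f)
  SpecialForm-X⊛ (a , k , l , a≉0 , f≋special) =
    a , k , suc l , a≉0 , S.trans (S.*-congˡ f≋special) (S.sym (special-suc-X a k l))

  SpecialForm-X-1⊛ : ∀ {f} → SpecialForm f → SpecialForm (X-1 ⊛ f)
  SpecialForm-X-1⊛ (a , k , l , a≉0 , f≋special) =
    a , suc k , l , a≉0 , S.trans (S.*-congˡ f≋special) (S.sym (special-suc-X-1 a k l))

  SpecialForm-cst : ∀ {a} → ¬ a ≈ 0# → SpecialForm (cst a)
  SpecialForm-cst {a} a≉0 = a , 0 , 0 , a≉0 , S.sym (special-zero a)

NoZeroDivisors : ∀ {c ℓ} → CommutativeRing c ℓ → Set (c ⊔ ℓ)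
NoZeroDivisors R = ∀ a b → a * b ≈ 0# → a ≈ 0# ⊎ b ≈ 0#
  where open CommutativeRing R

module Divisibility {c ℓ} (R : CommutativeRing c ℓ) (no-zero-divisors : NoZeroDivisors R) where
  open CommutativeRing R
  open Poly R
  open Sums R
  open PowerSeries R
  open Polynomials R

  Prime : Seq → Set (c ⊔ ℓ)
  Prime L = ∀ {A H} → IsPoly A → IsPoly H → L ∣ (A ⊛ H) → L ∣ A ⊎ L ∣ H

  X-prime : Prime X
  X-prime {A} {H} (a , A<a) (h , H<h) (Q , _ , XQ≋AH)
    with no-zero-divisors (A 0) (H 0) (trans (sym (XQ≋AH 0)) (coeff-X⊛-zero Q))
  ... | inj₁ A0≈0 = inj₁ (shift A , (a , DegBelow-shift A<a) , S.sym (X⊛shift A0≈0))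
  ... | inj₂ H0≈0 = inj₂ (shift H , (h , DegBelow-shift H<h) , S.sym (X⊛shift H0≈0))

  X-1-prime : Prime X-1
  X-1-prime {A} {H} (a , A<a) (h , H<h) (Q , (q , Q<q) , X-1Q≋AH)
    with no-zero-divisors (sumBelow a A) (sumBelow h H) values-at-1
    where
      N = a ℕ.+ h ℕ.+ q
      values-at-1 : sumBelow a A * sumBelow h H ≈ 0#
      values-at-1 = begin
        sumBelow a A * sumBelow h H  ≈⟨ sumBelow-⊛ A<a H<h ⟨
        sumBelow (a ℕ.+ h) (A ⊛ H)   ≈⟨ sumBelow-extend (suc N) (ℕP.m≤n⇒m≤1+n (ℕP.m≤m+n (a ℕ.+ h) q))
                                          (λ k a+h≤k _ → DegBelow-⊛ (DegBelow-mono (ℕP.n≤1+n a) A<a) H<h k a+h≤k) ⟨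
        sumBelow (suc N) (A ⊛ H)     ≈⟨ sumBelow-cong (suc N) (λ k _ → X-1Q≋AH k) ⟨
        sumBelow (suc N) (X-1 ⊛ Q)   ≈⟨ sumBelow-X-1⊛-vanishes Q<q (suc N) (s≤s (ℕP.m≤n+m q (a ℕ.+ h))) ⟩
        0#                           ∎
        where open import Relation.Binary.Reasoning.Setoid setoid
  ... | inj₁ A[1]≈0 = inj₁ (negPartialSums A , (a , DegBelow-negPartialSums A<a A[1]≈0) , X-1⊛negPartialSums A)
  ... | inj₂ H[1]≈0 = inj₂ (negPartialSums H , (h , DegBelow-negPartialSums H<h H[1]≈0) , X-1⊛negPartialSums H)

  prime-divisor-split : ∀ {L A P} → Prime L → (∀ {f g} → (L ⊛ f) ≋ (L ⊛ g) → f ≋ g) →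
                        IsPoly A → IsPoly P → A ∣ (L ⊛ P) →
                        (∃[ A′ ] (A ≋ (L ⊛ A′) × IsPoly A′ × A′ ∣ P)) ⊎ A ∣ P
  prime-divisor-split {L} {A} {P} L-prime L-cancel A-poly P-poly (H , H-poly , AH≋LP)
    with L-prime A-poly H-poly (P , P-poly , S.sym AH≋LP)
  ... | inj₁ (A′ , A′-poly , LA′≋A) = inj₁ (A′ , S.sym LA′≋A , A′-poly , H , H-poly , L-cancel (begin
    (L ⊛ (A′ ⊛ H))  ≈⟨ S.*-assoc L A′ H ⟨
    ((L ⊛ A′) ⊛ H)  ≈⟨ S.*-congʳ {H} LA′≋A ⟩
    (A ⊛ H)         ≈⟨ AH≋LP ⟩
    (L ⊛ P)         ∎))
    where open ≋-Reasoning
  ... | inj₂ (H′ , H′-poly , LH′≋H) = inj₂ (H′ , H′-poly , L-cancel (begin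
    (L ⊛ (A ⊛ H′))  ≈⟨ x∙yz≈y∙xz L A H′ ⟩
    (A ⊛ (L ⊛ H′))  ≈⟨ S.*-congˡ {A} LH′≋H ⟩
    (A ⊛ H)         ≈⟨ AH≋LP ⟩
    (L ⊛ P)         ∎))
    where open ≋-Reasoning
          open import Algebra.Properties.CommutativeSemigroup S.*-commutativeSemigroup using (x∙yz≈y∙xz)

  HasDegree : Seq → ℕ → Set ℓ
  HasDegree f t = ¬ f t ≈ 0# × DegBelow f (suc t)

  ¬¬-zero-or-HasDegree : ∀ {f} b → DegBelow f b → ¬ ¬ (DegBelow f 0 ⊎ ∃[ t ] HasDegree f t)
  ¬¬-zero-or-HasDegree zero    f<0 = contradiction (inj₁ f<0)
  ¬¬-zero-or-HasDegree {f} (suc b) f≤b = ¬¬-bind ¬¬-excluded-middle λ where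
    (yes fb≈0) → ¬¬-zero-or-HasDegree b (DegBelow-lower f≤b fb≈0)
    (no  fb≉0) → contradiction (inj₂ (b , fb≉0 , f≤b))

  HasDegree-⊛ : ∀ {f g a b} → HasDegree f a → HasDegree g b → ¬ (f ⊛ g) (a ℕ.+ b) ≈ 0#
  HasDegree-⊛ {a = a} {b} (fa≉0 , f≤a) (gb≉0 , g≤b) fg≈0
    with no-zero-divisors _ _ (trans (sym (coeff-⊛-top a b f≤a g≤b)) fg≈0)
  ... | inj₁ fa≈0 = fa≉0 fa≈0
  ... | inj₂ gb≈0 = gb≉0 gb≈0

  cst-divisor : ∀ {a A} → ¬ a ≈ 0# → IsPoly A → A ∣ cst a → ¬ ¬ SpecialForm A
  cst-divisor {a} {A} a≉0 (b , A<b) (H , (h , H<h) , AH≋a) = ¬¬-bind (¬¬-zero-or-HasDegree b A<b) λ where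
      (inj₁ A<0)                 → contradiction (trans (*-congʳ (A<0 0 z≤n)) (zeroˡ _)) value-at-0
      (inj₂ (zero , A0≉0 , A≤0)) → contradiction (SpecialForm-cong (A-constant A≤0) (SpecialForm-cst A0≉0))
      (inj₂ (suc t , A-deg))     → ¬¬-bind (¬¬-zero-or-HasDegree h H<h) λ where
        (inj₁ H<0)         → contradiction (trans (*-congˡ (H<0 0 z≤n)) (zeroʳ _)) value-at-0
        (inj₂ (u , H-deg)) → contradiction (AH≋a (suc t ℕ.+ u)) (HasDegree-⊛ A-deg H-deg)
    where
      value-at-0 : ¬ A 0 * H 0 ≈ 0#
      value-at-0 A0H0≈0 = a≉0 (trans (sym (AH≋a 0)) A0H0≈0)
      A-constant : DegBelow A 1 → cst (A 0) ≋ A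
      A-constant A≤0 zero    = refl
      A-constant A≤0 (suc k) = sym (A≤0 (suc k) (s≤s z≤n))

  special-divisor : ∀ {a} k l {A} → ¬ a ≈ 0# → IsPoly A → A ∣ special a k l → ¬ ¬ SpecialForm A
  special-divisor {a} k (suc l) a≉0 A-poly A∣
    with prime-divisor-split X-prime X⊛-cancel A-poly (IsPoly-special a k l) (∣-respʳ (special-suc-X a k l) A∣)
  ... | inj₁ (A′ , A≋XA′ , A′-poly , A′∣) =
    ¬¬-map (SpecialForm-cong (S.sym A≋XA′) ∘ SpecialForm-X⊛) (special-divisor k l a≉0 A′-poly A′∣)
  ... | inj₂ A∣′ = special-divisor k l a≉0 A-poly A∣′
  special-divisor {a} (suc k) zero a≉0 A-poly A∣
    with prime-divisor-split X-1-prime X-1⊛-cancel A-poly (IsPoly-special a k 0) (∣-respʳ (special-suc-X-1 a k 0) A∣)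
  ... | inj₁ (A′ , A≋X-1A′ , A′-poly , A′∣) =
    ¬¬-map (SpecialForm-cong (S.sym A≋X-1A′) ∘ SpecialForm-X-1⊛) (special-divisor k 0 a≉0 A′-poly A′∣)
  ... | inj₂ A∣′ = special-divisor k 0 a≉0 A-poly A∣′
  special-divisor {a} zero zero a≉0 A-poly A∣ = cst-divisor a≉0 A-poly (∣-respʳ (special-zero a) A∣)


module Substitution {c ℓ} (R : CommutativeRing c ℓ) where
  open CommutativeRing R
  open Poly R
  open Sums R
  open PowerSeries R
  open Polynomials R
  open Poly powerSeries using () renaming (_⊛₂_ to _⊛₂ˢ_)
  open import Algebra.Properties.CommutativeSemigroup S.*-commutativeSemigroup using (x∙yz≈y∙xz; interchange)

  -- The image of x^i y^j under U ↦ (y - 1)^D U(y/(y - 1), y), valid for i ≤ D.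
  substMonomial : ℕ → ℕ → ℕ → Seq
  substMonomial D i j = (X ^ˢ (i ℕ.+ j)) ⊛ (X-1 ^ˢ (D ∸ i))

  substTerm : Seq₂ → ℕ → ℕ → ℕ → Seq
  substTerm U D i j = cst (U i j) ⊛ substMonomial D i j

  substY-as-sum : ∀ U B D → substY U B D ≋ sumBelowˢ B (λ i → sumBelowˢ B (substTerm U D i))
  substY-as-sum U B D = S.trans (sumSeq≋sumBelowˢ B _) (Σˢ.sumBelow-cong B (λ i _ → sumSeq≋sumBelowˢ B _))

  substY-cong : ∀ {U V} B D → U ≋₂ V → substY U B D ≋ substY V B D
  substY-cong B D U≋V k =
    sumBelow-cong B (λ i _ → sumBelow-cong B (λ j _ → ⊛-cong (cst-cong (U≋V i j)) (S.refl {substMonomial D i j}) k))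

  substY-extend : ∀ {U B B′} D → Support₂ U B → B ≤ B′ → substY U B′ D ≋ substY U B D
  substY-extend {U} {B} {B′} D U-supp B≤B′ k =
    trans (sumBelow-extend B′ B≤B′ (λ i B≤i _ → sumBelow-zero B′ (λ j _ → vanishes i j (inj₁ B≤i))))
          (sumBelow-cong B (λ i _ → sumBelow-extend B′ B≤B′ (λ j B≤j _ → vanishes i j (inj₂ B≤j))))
    where
      vanishes : ∀ i j → B ≤ i ⊎ B ≤ j → substTerm U D i j k ≈ 0#
      vanishes i j outside = cst⊛-vanishes (substMonomial D i j) (U-supp i j outside) k

  substY-support-irrelevant : ∀ {U B B′} D → Support₂ U B → Support₂ U B′ → substY U B D ≋ substY U B′ D
  substY-support-irrelevant {B = B} {B′} D U-supp U-supp′ =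
    S.trans (S.sym (substY-extend D U-supp (ℕP.m≤m+n B B′))) (substY-extend D U-supp′ (ℕP.m≤n+m B′ B))

  ⊛-distrib-substY : ∀ f U B D → (f ⊛ substY U B D) ≋ sumBelowˢ B (λ i → sumBelowˢ B (λ j → f ⊛ substTerm U D i j))
  ⊛-distrib-substY f U B D =
    S.trans (S.*-congˡ {f} (substY-as-sum U B D))
            (S.trans (Σˢ.*-distribˡ-sumBelow B f _) (Σˢ.sumBelow-cong B (λ i _ → Σˢ.*-distribˡ-sumBelow B f _)))

  X-1ᵃ⊛substTerm : ∀ U a D i j →
    ((X-1 ^ˢ a) ⊛ substTerm U D i j) ≋ (cst (U i j) ⊛ ((X ^ˢ (i ℕ.+ j)) ⊛ (X-1 ^ˢ (a ℕ.+ (D ∸ i)))))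
  X-1ᵃ⊛substTerm U a D i j =
    S.trans (x∙yz≈y∙xz (X-1 ^ˢ a) (cst (U i j)) (substMonomial D i j))
            (S.*-congˡ {cst (U i j)} (S.trans (x∙yz≈y∙xz (X-1 ^ˢ a) (X ^ˢ (i ℕ.+ j)) (X-1 ^ˢ (D ∸ i)))
                                              (S.*-congˡ {X ^ˢ (i ℕ.+ j)} (S.sym (^ˢ-+ X-1 a (D ∸ i))))))

  substY-rescale : ∀ {U B} a b D D′ → (∀ i j → i < B → U i j ≈ 0# ⊎ (i ≤ D × i ≤ D′ × a ℕ.+ D ≡ b ℕ.+ D′)) →
                   ((X-1 ^ˢ a) ⊛ substY U B D) ≋ ((X-1 ^ˢ b) ⊛ substY U B D′)
  substY-rescale {U} {B} a b D D′ termwise =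
    S.trans (⊛-distrib-substY _ U B D)
            (S.trans (Σˢ.sumBelow-cong B (λ i i<B → Σˢ.sumBelow-cong B (λ j _ → rescaleTerm i j (termwise i j i<B))))
                     (S.sym (⊛-distrib-substY _ U B D′)))
    where
      rescaleTerm : ∀ i j → U i j ≈ 0# ⊎ (i ≤ D × i ≤ D′ × a ℕ.+ D ≡ b ℕ.+ D′) →
                    ((X-1 ^ˢ a) ⊛ substTerm U D i j) ≋ ((X-1 ^ˢ b) ⊛ substTerm U D′ i j)
      rescaleTerm i j (inj₁ Uij≈0) =
        S.trans (S.*-congˡ {X-1 ^ˢ a} (cst⊛-vanishes (substMonomial D i j) Uij≈0))
                (S.trans (S.zeroʳ (X-1 ^ˢ a))
                         (S.sym (S.trans (S.*-congˡ {X-1 ^ˢ b} (cst⊛-vanishes (substMonomial D′ i j) Uij≈0))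
                                         (S.zeroʳ (X-1 ^ˢ b)))))
      rescaleTerm i j (inj₂ (i≤D , i≤D′ , a+D≡b+D′)) =
        S.trans (X-1ᵃ⊛substTerm U a D i j)
                (S.trans (S.reflexive (≡.cong (λ e → cst (U i j) ⊛ ((X ^ˢ (i ℕ.+ j)) ⊛ (X-1 ^ˢ e))) exponents))
                         (S.sym (X-1ᵃ⊛substTerm U b D′ i j)))
        where
          exponents : a ℕ.+ (D ∸ i) ≡ b ℕ.+ (D′ ∸ i)
          exponents = ≡.trans (≡.sym (ℕP.+-∸-assoc a i≤D))
                              (≡.trans (≡.cong (_∸ i) a+D≡b+D′) (ℕP.+-∸-assoc b i≤D′))

  substY-shift : ∀ {U B} e D → B ≤ suc D → substY U B (e ℕ.+ D) ≋ ((X-1 ^ˢ e) ⊛ substY U B D)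
  substY-shift e D B≤1+D =
    S.trans (S.sym (⊛-identityˡ _))
            (substY-rescale 0 e (e ℕ.+ D) D (λ i j i<B →
              let i≤D = ℕP.≤-pred (ℕP.≤-trans i<B B≤1+D) in inj₂ (ℕP.≤-trans i≤D (ℕP.m≤n+m D e) , i≤D , ≡.refl)))

  Support₂-⊛₂ : ∀ {F G B₁ B₂} → Support₂ F B₁ → Support₂ G B₂ → Support₂ (F ⊛₂ G) (B₁ ℕ.+ B₂)
  Support₂-⊛₂ {F} {G} {B₁} {B₂} F-supp G-supp n m outside =
    trans (sumTo≈sumBelow n _) (sumBelow-zero (suc n) (λ i _ →
      trans (sumTo≈sumBelow m _) (sumBelow-zero (suc m) (λ j _ → term i j outside))))
    where
      beyond : ∀ {i k} → i < B₁ → B₁ ℕ.+ B₂ ≤ k → B₂ ≤ k ∸ i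
      beyond {i} i<B₁ B₁+B₂≤k = ℕP.m+n≤o⇒m≤o∸n B₂ (ℕP.≤-trans (ℕP.+-monoʳ-≤ B₂ (ℕP.<⇒≤ i<B₁))
                                                  (ℕP.≤-trans (ℕP.≤-reflexive (ℕP.+-comm B₂ B₁)) B₁+B₂≤k))
      term : ∀ i j → B₁ ℕ.+ B₂ ≤ n ⊎ B₁ ℕ.+ B₂ ≤ m → F i j * G (n ∸ i) (m ∸ j) ≈ 0#
      term i j (inj₁ B≤n) with B₁ ℕP.≤? i
      ... | yes B₁≤i = trans (*-congʳ (F-supp i j (inj₁ B₁≤i))) (zeroˡ _)
      ... | no  B₁≰i = trans (*-congˡ (G-supp _ _ (inj₁ (beyond (ℕP.≰⇒> B₁≰i) B≤n)))) (zeroʳ _)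
      term i j (inj₂ B≤m) with B₁ ℕP.≤? j
      ... | yes B₁≤j = trans (*-congʳ (F-supp i j (inj₂ B₁≤j))) (zeroˡ _)
      ... | no  B₁≰j = trans (*-congˡ (G-supp _ _ (inj₂ (beyond (ℕP.≰⇒> B₁≰j) B≤m)))) (zeroʳ _)

  Support₂-cong : ∀ {F G B} → F ≋₂ G → Support₂ F B → Support₂ G B
  Support₂-cong F≋G F-supp i j outside = trans (sym (F≋G i j)) (F-supp i j outside)

  substMonomial-⊛ : ∀ {D₁ D₂ i i′} j j′ → i ≤ D₁ → i′ ≤ D₂ →
    substMonomial (D₁ ℕ.+ D₂) (i ℕ.+ i′) (j ℕ.+ j′) ≋ (substMonomial D₁ i j ⊛ substMonomial D₂ i′ j′)
  substMonomial-⊛ {D₁} {D₂} {i} {i′} j j′ i≤D₁ i′≤D₂ = begin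
    (X ^ˢ (i ℕ.+ i′ ℕ.+ (j ℕ.+ j′))) ⊛ (X-1 ^ˢ (D₁ ℕ.+ D₂ ∸ (i ℕ.+ i′)))
      ≡⟨ ≡.cong₂ (λ d e → (X ^ˢ d) ⊛ (X-1 ^ˢ e)) (+-interchange i i′ j j′) exponent-of-X-1 ⟩
    (X ^ˢ (i ℕ.+ j ℕ.+ (i′ ℕ.+ j′))) ⊛ (X-1 ^ˢ ((D₁ ∸ i) ℕ.+ (D₂ ∸ i′)))
      ≈⟨ S.*-cong (^ˢ-+ X (i ℕ.+ j) (i′ ℕ.+ j′)) (^ˢ-+ X-1 (D₁ ∸ i) (D₂ ∸ i′)) ⟩
    ((X ^ˢ (i ℕ.+ j)) ⊛ (X ^ˢ (i′ ℕ.+ j′))) ⊛ ((X-1 ^ˢ (D₁ ∸ i)) ⊛ (X-1 ^ˢ (D₂ ∸ i′)))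
      ≈⟨ interchange (X ^ˢ (i ℕ.+ j)) (X ^ˢ (i′ ℕ.+ j′)) (X-1 ^ˢ (D₁ ∸ i)) (X-1 ^ˢ (D₂ ∸ i′)) ⟩
    substMonomial D₁ i j ⊛ substMonomial D₂ i′ j′  ∎
    where
      open ≋-Reasoning
      open import Algebra.Properties.CommutativeSemigroup ℕP.+-commutativeSemigroup
        using () renaming (interchange to +-interchange)
      exponent-of-X-1 : D₁ ℕ.+ D₂ ∸ (i ℕ.+ i′) ≡ (D₁ ∸ i) ℕ.+ (D₂ ∸ i′)
      exponent-of-X-1 = ≡.trans (≡.sym (ℕP.∸-+-assoc (D₁ ℕ.+ D₂) i i′))
                          (≡.trans (≡.cong (_∸ i′) (ℕP.+-∸-comm D₂ i≤D₁)) (ℕP.+-∸-assoc (D₁ ∸ i) i′≤D₂))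

  cst-⊛₂ : ∀ F G n m → cst ((F ⊛₂ G) n m) ≋ ((λ i j → cst (F i j)) ⊛₂ˢ (λ i j → cst (G i j))) n m
  cst-⊛₂ F G n m = begin
    cst (sumTo n (λ i → sumTo m (λ j → F i j * G (n ∸ i) (m ∸ j))))
      ≈⟨ cst-cong (trans (sumTo≈sumBelow n _) (sumBelow-cong (suc n) (λ i _ → sumTo≈sumBelow m _))) ⟩
    cst (sumBelow (suc n) (λ i → sumBelow (suc m) (λ j → F i j * G (n ∸ i) (m ∸ j))))
      ≈⟨ S.trans (cst-sumBelow (suc n) _) (Σˢ.sumBelow-cong (suc n) (λ i _ →
           S.trans (cst-sumBelow (suc m) _) (Σˢ.sumBelow-cong (suc m) (λ j _ → cst-* (F i j) _)))) ⟩
    sumBelowˢ (suc n) (λ i → sumBelowˢ (suc m) (λ j → cst (F i j) ⊛ cst (G (n ∸ i) (m ∸ j))))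
      ≈⟨ S.trans (Σˢ.sumTo≈sumBelow n _) (Σˢ.sumBelow-cong (suc n) (λ i _ → Σˢ.sumTo≈sumBelow m (λ j → product i j))) ⟨
    ((λ i j → cst (F i j)) ⊛₂ˢ (λ i j → cst (G i j))) n m  ∎
    where
      open ≋-Reasoning
      product : ℕ → ℕ → Seq
      product i j = cst (F i j) ⊛ cst (G (n ∸ i) (m ∸ j))

  substY-⊛₂ : ∀ {F G B₁ B₂ D₁ D₂} → Support₂ F B₁ → Support₂ G B₂ → B₁ ≤ suc D₁ → B₂ ≤ suc D₂ →
              substY (F ⊛₂ G) (B₁ ℕ.+ B₂) (D₁ ℕ.+ D₂) ≋ (substY F B₁ D₁ ⊛ substY G B₂ D₂)
  substY-⊛₂ {F} {G} {B₁} {B₂} {D₁} {D₂} F-supp G-supp B₁≤1+D₁ B₂≤1+D₂ = begin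
    substY (F ⊛₂ G) N (D₁ ℕ.+ D₂)
      ≈⟨ substY-as-sum (F ⊛₂ G) N (D₁ ℕ.+ D₂) ⟩
    sumBelowˢ N (λ n → sumBelowˢ N (λ m → cst ((F ⊛₂ G) n m) ⊛ W n m))
      ≈⟨ Σˢ.sumBelow-cong N (λ n _ → Σˢ.sumBelow-cong N (λ m _ → S.*-congʳ {W n m} (cst-⊛₂ F G n m))) ⟩
    sumBelowˢ N (λ n → sumBelowˢ N (λ m → (F′ ⊛₂ˢ G′) n m ⊛ W n m))
      ≈⟨ Σˢ.sumBelow-cauchy₂ N F′ G′ W (cst-support F-supp) (cst-support G-supp) ℕP.≤-refl ⟩
    sumBelowˢ B₁ (λ i → sumBelowˢ B₁ (λ j → sumBelowˢ B₂ (λ i′ → sumBelowˢ B₂ (λ j′ →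
      (F′ i j ⊛ G′ i′ j′) ⊛ W (i ℕ.+ i′) (j ℕ.+ j′)))))
      ≈⟨ Σˢ.sumBelow-cong B₁ (λ i i<B₁ → Σˢ.sumBelow-cong B₁ (λ j _ → Σˢ.sumBelow-cong B₂ (λ i′ i′<B₂ →
           Σˢ.sumBelow-cong B₂ (λ j′ _ → factor i j i′ j′ (ℕP.≤-pred (ℕP.≤-trans i<B₁ B₁≤1+D₁))
                                                          (ℕP.≤-pred (ℕP.≤-trans i′<B₂ B₂≤1+D₂)))))) ⟩
    sumBelowˢ B₁ (λ i → sumBelowˢ B₁ (λ j → sumBelowˢ B₂ (λ i′ → sumBelowˢ B₂ (λ j′ →
      substTerm F D₁ i j ⊛ substTerm G D₂ i′ j′))))
      ≈⟨ Σˢ.*-distrib-sumBelow₂ B₁ B₁ B₂ B₂ (substTerm F D₁) (substTerm G D₂) ⟨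
    sumBelowˢ B₁ (λ i → sumBelowˢ B₁ (substTerm F D₁ i)) ⊛ sumBelowˢ B₂ (λ i → sumBelowˢ B₂ (substTerm G D₂ i))
      ≈⟨ S.*-cong (substY-as-sum F B₁ D₁) (substY-as-sum G B₂ D₂) ⟨
    substY F B₁ D₁ ⊛ substY G B₂ D₂  ∎
    where
      open ≋-Reasoning
      N = B₁ ℕ.+ B₂
      W = substMonomial (D₁ ℕ.+ D₂)
      F′ G′ : ℕ → ℕ → Seq
      F′ i j = cst (F i j)
      G′ i j = cst (G i j)
      cst-support : ∀ {H B} → Support₂ H B → Poly.Support₂ powerSeries (λ i j → cst (H i j)) B
      cst-support H-supp i j outside = S.trans (cst-cong (H-supp i j outside)) cst-0
      factor : ∀ i j i′ j′ → i ≤ D₁ → i′ ≤ D₂ →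
               ((F′ i j ⊛ G′ i′ j′) ⊛ W (i ℕ.+ i′) (j ℕ.+ j′)) ≋ (substTerm F D₁ i j ⊛ substTerm G D₂ i′ j′)
      factor i j i′ j′ i≤D₁ i′≤D₂ =
        S.trans (S.*-congˡ {F′ i j ⊛ G′ i′ j′} (substMonomial-⊛ j j′ i≤D₁ i′≤D₂))
                (interchange (F′ i j) (G′ i′ j′) (substMonomial D₁ i j) (substMonomial D₂ i′ j′))

  DegBelow-substTerm : ∀ U D i j → DegBelow (substTerm U D i j) (suc (i ℕ.+ j ℕ.+ (D ∸ i)))
  DegBelow-substTerm U D i j =
    DegBelow-cst⊛ (U i j) (proj₁ (Monic-⊛ (Monic-^ˢ-linear (i ℕ.+ j) Monic-X) (Monic-^ˢ-linear (D ∸ i) Monic-X-1)))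

  IsPoly-substY : ∀ U B D → IsPoly (substY U B D)
  IsPoly-substY U B D =
    IsPoly-sumSeq B _ (λ i _ → IsPoly-sumSeq B _ (λ j _ → _ , DegBelow-substTerm U D i j))

  substY-DegBelow : ∀ {U B D T} → B ≤ suc D → (∀ i j → T ≤ j ℕ.+ D → U i j ≈ 0#) → DegBelow (substY U B D) T
  substY-DegBelow {U} {B} {D} {T} B≤1+D vanish k T≤k =
    sumBelow-zero B (λ i i<B → sumBelow-zero B (λ j _ → term i j (ℕP.≤-pred (ℕP.≤-trans i<B B≤1+D))))
    where
      term : ∀ i j → i ≤ D → substTerm U D i j k ≈ 0#
      term i j i≤D with T ℕP.≤? j ℕ.+ D
      ... | yes T≤j+D = cst⊛-vanishes (substMonomial D i j) (vanish i j T≤j+D) k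
      ... | no  T≰j+D = DegBelow-substTerm U D i j k
                          (ℕP.≤-trans (ℕP.≤-reflexive (≡.cong suc degree)) (ℕP.≤-trans (ℕP.≰⇒> T≰j+D) T≤k))
        where
          degree : i ℕ.+ j ℕ.+ (D ∸ i) ≡ j ℕ.+ D
          degree = ≡.trans (≡.cong (ℕ._+ (D ∸ i)) (ℕP.+-comm i j))
                     (≡.trans (ℕP.+-assoc j i (D ∸ i)) (≡.cong (j ℕ.+_) (ℕP.m+[n∸m]≡n i≤D)))

module UnivariateSubstitution {c ℓ} (R : CommutativeRing c ℓ) where
  open CommutativeRing R
  open Poly R
  open Sums R
  open PowerSeries R
  open Polynomials R
  open Substitution R

  -- substX N g = (y - 1)^N g(y/(y - 1)), for g of degree at most N.
  substX : ℕ → Seq → Seq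
  substX N g = substY (embedX g) (suc N) N

  Support₂-embedX : ∀ {g b} → DegBelow g b → Support₂ (embedX g) b
  Support₂-embedX g<b i zero    (inj₁ b≤i) = g<b i b≤i
  Support₂-embedX g<b i zero    (inj₂ b≤0) = g<b i (ℕP.≤-trans b≤0 z≤n)
  Support₂-embedX g<b i (suc j) _          = refl

  embedX-⊛₂ : ∀ f g → (embedX f ⊛₂ embedX g) ≋₂ embedX (f ⊛ g)
  embedX-⊛₂ f g n zero    = refl
  embedX-⊛₂ f g n (suc m) =
    trans (sumTo≈sumBelow n _) (sumBelow-zero (suc n) (λ i _ →
      trans (sumTo≈sumBelow (suc m) _) (sumBelow-zero (suc (suc m)) (λ j _ → term i j))))
    where
      term : ∀ i j → embedX f i j * embedX g (n ∸ i) (suc m ∸ j) ≈ 0#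
      term i zero    = zeroʳ _
      term i (suc j) = zeroˡ _

  substX-cong : ∀ N {f g} → f ≋ g → substX N f ≋ substX N g
  substX-cong N f≋g = substY-cong (suc N) N embedX-cong
    where
      embedX-cong : embedX _ ≋₂ embedX _
      embedX-cong i zero    = f≋g i
      embedX-cong i (suc j) = refl

  substX-expansion : ∀ N g → substX N g ≋ sumBelowˢ (suc N) (λ i → cst (g i) ⊛ substMonomial N i 0)
  substX-expansion N g =
    S.trans (substY-as-sum (embedX g) (suc N) N)
            (Σˢ.sumBelow-cong (suc N) (λ i _ → Σˢ.sumBelow-single (suc N) 0 (s≤s z≤n) (λ where
              zero    _ 0≢0 → contradiction ≡.refl 0≢0
              (suc j) _ _   → cst⊛-vanishes (substMonomial N i (suc j)) refl)))

  substX-linear : ∀ N n (a : ℕ → Carrier) (h : ℕ → Seq) →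
    substX N (sumBelowˢ n (λ k → cst (a k) ⊛ h k)) ≋ sumBelowˢ n (λ k → cst (a k) ⊛ substX N (h k))
  substX-linear N n a h = begin
    substX N (sumBelowˢ n (λ k → cst (a k) ⊛ h k))
      ≈⟨ substX-expansion N _ ⟩
    sumBelowˢ (suc N) (λ i → cst (sumBelowˢ n (λ k → cst (a k) ⊛ h k) i) ⊛ b i)
      ≈⟨ Σˢ.sumBelow-cong (suc N) (λ i _ → S.*-congʳ {b i} (coefficient i)) ⟩
    sumBelowˢ (suc N) (λ i → sumBelowˢ n (λ k → cst (a k) ⊛ cst (h k i)) ⊛ b i)
      ≈⟨ Σˢ.sumBelow-cong (suc N) (λ i _ → Σˢ.*-distribʳ-sumBelow n (b i) _) ⟩
    sumBelowˢ (suc N) (λ i → sumBelowˢ n (λ k → (cst (a k) ⊛ cst (h k i)) ⊛ b i))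
      ≈⟨ Σˢ.sumBelow-comm (suc N) n _ ⟩
    sumBelowˢ n (λ k → sumBelowˢ (suc N) (λ i → (cst (a k) ⊛ cst (h k i)) ⊛ b i))
      ≈⟨ Σˢ.sumBelow-cong n (λ k _ → S.trans (Σˢ.sumBelow-cong (suc N) (λ i _ → S.*-assoc _ _ (b i)))
                                             (S.sym (Σˢ.*-distribˡ-sumBelow (suc N) (cst (a k)) _))) ⟩
    sumBelowˢ n (λ k → cst (a k) ⊛ sumBelowˢ (suc N) (λ i → cst (h k i) ⊛ b i))
      ≈⟨ Σˢ.sumBelow-cong n (λ k _ → S.*-congˡ {cst (a k)} (substX-expansion N (h k))) ⟨
    sumBelowˢ n (λ k → cst (a k) ⊛ substX N (h k))  ∎
    where
      open ≋-Reasoning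
      b : ℕ → Seq
      b i = substMonomial N i 0
      coefficient : ∀ i → cst (sumBelowˢ n (λ k → cst (a k) ⊛ h k) i) ≋ sumBelowˢ n (λ k → cst (a k) ⊛ cst (h k i))
      coefficient i =
        S.trans (cst-cong (trans (reflexive (coeff-sumBelowˢ n _ i))
                                 (sumBelow-cong n (λ k _ → coeff-cst-⊛ (a k) (h k) i))))
                (S.trans (cst-sumBelow n _) (Σˢ.sumBelow-cong n (λ k _ → cst-* (a k) (h k i))))

  substX-scale : ∀ N a g → substX N (cst a ⊛ g) ≋ (cst a ⊛ substX N g)
  substX-scale N a g =
    S.trans (substX-cong N (S.sym (S.+-identityˡ _)))
            (S.trans (substX-linear N 1 (λ _ → a) (λ _ → g)) (S.+-identityˡ _))

  substX-⊛ : ∀ {f g} a b → DegBelow f (suc a) → DegBelow g (suc b) →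
             substX (a ℕ.+ b) (f ⊛ g) ≋ (substX a f ⊛ substX b g)
  substX-⊛ {f} {g} a b f≤a g≤b =
    S.trans (substY-support-irrelevant (a ℕ.+ b) (Support₂-embedX fg≤a+b)
                                                 (Support₂-embedX (DegBelow-mono a+b<2+a+b fg≤a+b)))
            (S.trans (substY-cong (suc a ℕ.+ suc b) (a ℕ.+ b) (λ i j → sym (embedX-⊛₂ f g i j)))
                     (substY-⊛₂ (Support₂-embedX f≤a) (Support₂-embedX g≤b) ℕP.≤-refl ℕP.≤-refl))
    where
      fg≤a+b : DegBelow (f ⊛ g) (suc (a ℕ.+ b))
      fg≤a+b = DegBelow-mono (ℕP.≤-reflexive (ℕP.+-suc a b)) (DegBelow-⊛ f≤a g≤b)
      a+b<2+a+b : suc (a ℕ.+ b) ≤ suc a ℕ.+ suc b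
      a+b<2+a+b = s≤s (ℕP.+-monoʳ-≤ a (ℕP.n≤1+n b))

  substX-shift : ∀ {g} e N → DegBelow g (suc N) → substX (e ℕ.+ N) g ≋ ((X-1 ^ˢ e) ⊛ substX N g)
  substX-shift e N g≤N =
    S.trans (substY-extend (e ℕ.+ N) (Support₂-embedX g≤N) (s≤s (ℕP.m≤n+m N e))) (substY-shift e N ℕP.≤-refl)

  substX-degree-one : ∀ g → substX 1 g ≋ ((cst (g 0) ⊛ X-1) ⊕ (cst (g 1) ⊛ X))
  substX-degree-one g =
    S.trans (substX-expansion 1 g)
            (S.+-cong (S.trans (S.+-identityˡ _) (S.*-congˡ {cst (g 0)} (S.trans (S.*-identityˡ _) (S.*-identityʳ X-1))))
                      (S.*-congˡ {cst (g 1)} (S.trans (S.*-identityʳ _) (S.*-identityʳ X))))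

  substX-X : substX 1 X ≋ X
  substX-X = S.trans (substX-degree-one X)
                     (S.trans (S.+-cong (cst⊛-vanishes X-1 refl) (⊛-identityˡ X)) (S.+-identityˡ X))

  substX-X-1 : substX 1 X-1 ≋ cst 1#
  substX-X-1 = begin
    substX 1 X-1                                           ≈⟨ substX-degree-one X-1 ⟩
    cst (0# + - 1#) S.* X-1 S.+ cst (1# + 0#) S.* X          ≈⟨ S.+-cong (S.*-cong -1≋ X-1≋) (S.*-congʳ {X} (cst-cong (+-identityʳ 1#))) ⟩
    S.- S.1# S.* (X S.- S.1#) S.+ S.1# S.* X                 ≈⟨ S.+-cong (-1*x≈-x _) (S.*-identityˡ X) ⟩
    S.- (X S.- S.1#) S.+ X                                   ≈⟨ S.+-congʳ (⁻¹-anti-homo‿- X S.1#) ⟩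
    S.1# S.- X S.+ X                                         ≈⟨ S.+-assoc S.1# (S.- X) X ⟩
    S.1# S.+ (S.- X S.+ X)                                   ≈⟨ S.+-congˡ (S.-‿inverseˡ X) ⟩
    S.1# S.+ S.0#                                            ≈⟨ S.+-identityʳ S.1# ⟩
    cst 1#                                               ∎
    where
      open ≋-Reasoning
      open import Algebra.Properties.Ring S.ring using (-1*x≈-x)
      open import Algebra.Properties.AbelianGroup S.+-abelianGroup using (⁻¹-anti-homo‿-)
      open import Algebra.Properties.Ring ring using (-0#≈0#)
      -1≋ : cst (0# + - 1#) ≋ (S.- S.1#)
      -1≋ zero    = +-identityˡ _
      -1≋ (suc k) = sym -0#≈0#
      X-1≋ : X-1 ≋ (X S.- S.1#)
      X-1≋ zero    = refl
      X-1≋ (suc k) = +-congˡ (sym -0#≈0#)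

  substX-cst : ∀ b → substX 0 (cst b) ≋ cst b
  substX-cst b = S.trans (substX-expansion 0 (cst b)) (S.trans (S.+-identityˡ _) (special-zero b))

  substX-^ˢ : ∀ {g r} → Monic g 1 → substX 1 g ≋ r → ∀ k → substX k (g ^ˢ k) ≋ (r ^ˢ k)
  substX-^ˢ g-monic g↦r zero    = substX-cst 1#
  substX-^ˢ g-monic g↦r (suc k) =
    S.trans (substX-⊛ 1 k (proj₁ g-monic) (proj₁ (Monic-^ˢ-linear k g-monic)))
            (S.*-cong g↦r (substX-^ˢ g-monic g↦r k))

  cst1-^ˢ : ∀ k → (cst 1# ^ˢ k) ≋ cst 1#
  cst1-^ˢ zero    = S.refl
  cst1-^ˢ (suc k) = S.trans (⊛-identityˡ _) (cst1-^ˢ k)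

  -- Since y/(y - 1) - 1 = 1/(y - 1), the substitution sends a(x - 1)^k x^l to a(y - 1)^e y^l.
  substX-special : ∀ a e k l → substX (e ℕ.+ (k ℕ.+ l)) (special a k l) ≋ special a e l
  substX-special a e k l = begin
    substX (e ℕ.+ (k ℕ.+ l)) (special a k l)
      ≈⟨ substX-shift e (k ℕ.+ l) (DegBelow-special a k l) ⟩
    (X-1 ^ˢ e) ⊛ substX (k ℕ.+ l) (special a k l)
      ≈⟨ S.*-congˡ {X-1 ^ˢ e} (substX-scale (k ℕ.+ l) a _) ⟩
    (X-1 ^ˢ e) ⊛ (cst a ⊛ substX (k ℕ.+ l) ((X-1 ^ˢ k) ⊛ (X ^ˢ l)))
      ≈⟨ S.*-congˡ {X-1 ^ˢ e} (S.*-congˡ {cst a} (substX-⊛ k l (proj₁ (Monic-^ˢ-linear k Monic-X-1))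
                                                                (proj₁ (Monic-^ˢ-linear l Monic-X)))) ⟩
    (X-1 ^ˢ e) ⊛ (cst a ⊛ (substX k (X-1 ^ˢ k) ⊛ substX l (X ^ˢ l)))
      ≈⟨ S.*-congˡ {X-1 ^ˢ e} (S.*-congˡ {cst a} (S.*-cong
           (S.trans (substX-^ˢ Monic-X-1 substX-X-1 k) (cst1-^ˢ k)) (substX-^ˢ Monic-X substX-X l))) ⟩
    (X-1 ^ˢ e) ⊛ (cst a ⊛ (cst 1# ⊛ (X ^ˢ l)))
      ≈⟨ S.*-congˡ {X-1 ^ˢ e} (S.*-congˡ {cst a} (⊛-identityˡ (X ^ˢ l))) ⟩
    (X-1 ^ˢ e) ⊛ (cst a ⊛ (X ^ˢ l))
      ≈⟨ x∙yz≈y∙xz (X-1 ^ˢ e) (cst a) (X ^ˢ l) ⟩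
    special a e l  ∎
    where
      open ≋-Reasoning
      open import Algebra.Properties.CommutativeSemigroup S.*-commutativeSemigroup using (x∙yz≈y∙xz)

  substX-substMonomial : ∀ {N i} → i ≤ N → substX N (substMonomial N i 0) ≋ (X ^ˢ i)
  substX-substMonomial {N} {i} i≤N = begin
    substX N (substMonomial N i 0)
      ≈⟨ substX-cong N (S.trans (S.*-comm _ _) (S.sym (⊛-identityˡ _))) ⟩
    substX N (special 1# (N ∸ i) (i ℕ.+ 0))
      ≡⟨ ≡.cong (λ t → substX t (special 1# (N ∸ i) (i ℕ.+ 0))) (≡.sym N≡) ⟩
    substX (0 ℕ.+ ((N ∸ i) ℕ.+ (i ℕ.+ 0))) (special 1# (N ∸ i) (i ℕ.+ 0))
      ≈⟨ substX-special 1# 0 (N ∸ i) (i ℕ.+ 0) ⟩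
    special 1# 0 (i ℕ.+ 0)
      ≈⟨ S.trans (⊛-identityˡ _) (⊛-identityˡ _) ⟩
    X ^ˢ (i ℕ.+ 0)
      ≡⟨ ≡.cong (X ^ˢ_) (ℕP.+-identityʳ i) ⟩
    X ^ˢ i  ∎
    where
      open ≋-Reasoning
      N≡ : (N ∸ i) ℕ.+ (i ℕ.+ 0) ≡ N
      N≡ = ≡.trans (≡.cong ((N ∸ i) ℕ.+_) (ℕP.+-identityʳ i)) (ℕP.m∸n+n≡m i≤N)

  DegBelow-substX : ∀ N f → DegBelow (substX N f) (suc N)
  DegBelow-substX N f = substY-DegBelow ℕP.≤-refl λ where
    i zero    1+N≤N → contradiction 1+N≤N (ℕP.n≮n N)
    i (suc j) _     → refl

  substX-involutive : ∀ {N f} → DegBelow f (suc N) → substX N (substX N f) ≋ f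
  substX-involutive {N} {f} f≤N = begin
    substX N (substX N f)
      ≈⟨ substX-cong N (substX-expansion N f) ⟩
    substX N (sumBelowˢ (suc N) (λ i → cst (f i) ⊛ substMonomial N i 0))
      ≈⟨ substX-linear N (suc N) f (λ i → substMonomial N i 0) ⟩
    sumBelowˢ (suc N) (λ i → cst (f i) ⊛ substX N (substMonomial N i 0))
      ≈⟨ Σˢ.sumBelow-cong (suc N) (λ i i≤N → S.*-congˡ {cst (f i)} (substX-substMonomial (ℕP.≤-pred i≤N))) ⟩
    sumBelowˢ (suc N) (λ i → cst (f i) ⊛ (X ^ˢ i))
      ≈⟨ monomial-expansion f≤N ⟩
    f  ∎
    where open ≋-Reasoning

  SpecialForm-substX : ∀ {N f a k l} → DegBelow f (suc N) → ¬ a ≈ 0# → substX N f ≋ special a k l → SpecialForm f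
  SpecialForm-substX {N} {f} {a} {k} {l} f≤N a≉0 f↦special with k ℕ.+ l ℕP.≤? N
  ... | no  k+l≰N = contradiction (begin
      a                        ≈⟨ coeff-special-top a k l ⟨
      special a k l (k ℕ.+ l)  ≈⟨ f↦special (k ℕ.+ l) ⟨
      substX N f (k ℕ.+ l)     ≈⟨ DegBelow-substX N f (k ℕ.+ l) (ℕP.≰⇒> k+l≰N) ⟩
      0#                       ∎) a≉0
    where open import Relation.Binary.Reasoning.Setoid setoid
  ... | yes k+l≤N = a , N ∸ (k ℕ.+ l) , l , a≉0 , (begin
      f                                                 ≈⟨ substX-involutive f≤N ⟨
      substX N (substX N f)                             ≈⟨ substX-cong N f↦special ⟩
      substX N (special a k l)                          ≡⟨ ≡.cong (λ t → substX t (special a k l)) (≡.sym (ℕP.m∸n+n≡m k+l≤N)) ⟩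
      substX (N ∸ (k ℕ.+ l) ℕ.+ (k ℕ.+ l)) (special a k l)  ≈⟨ substX-special a (N ∸ (k ℕ.+ l)) k l ⟩
      special a (N ∸ (k ℕ.+ l)) l                       ∎)
    where open ≋-Reasoning

  Support₂-embedY : ∀ {g b} → DegBelow g b → Support₂ (embedY g) b
  Support₂-embedY g<b zero    j (inj₁ b≤0) = g<b j (ℕP.≤-trans b≤0 z≤n)
  Support₂-embedY g<b zero    j (inj₂ b≤j) = g<b j b≤j
  Support₂-embedY g<b (suc i) j _          = refl

  substY-embedY : ∀ {d f} → DegBelow f (suc d) → substY (embedY f) (suc d) d ≋ (f ⊛ (X-1 ^ˢ d))
  substY-embedY {d} {f} f≤d = begin
    substY (embedY f) (suc d) d
      ≈⟨ substY-as-sum (embedY f) (suc d) d ⟩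
    sumBelowˢ (suc d) (λ i → sumBelowˢ (suc d) (substTerm (embedY f) d i))
      ≈⟨ Σˢ.sumBelow-single (suc d) 0 (s≤s z≤n) (λ where
           zero    _ 0≢0 → contradiction ≡.refl 0≢0
           (suc i) _ _   → Σˢ.sumBelow-zero (suc d) (λ j _ → cst⊛-vanishes (substMonomial d (suc i) j) refl)) ⟩
    sumBelowˢ (suc d) (λ j → cst (f j) ⊛ ((X ^ˢ j) ⊛ (X-1 ^ˢ d)))
      ≈⟨ Σˢ.sumBelow-cong (suc d) (λ j _ → S.sym (S.*-assoc (cst (f j)) (X ^ˢ j) (X-1 ^ˢ d))) ⟩
    sumBelowˢ (suc d) (λ j → (cst (f j) ⊛ (X ^ˢ j)) ⊛ (X-1 ^ˢ d))
      ≈⟨ Σˢ.*-distribʳ-sumBelow (suc d) (X-1 ^ˢ d) _ ⟨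
    sumBelowˢ (suc d) (λ j → cst (f j) ⊛ (X ^ˢ j)) ⊛ (X-1 ^ˢ d)
      ≈⟨ S.*-congʳ {X-1 ^ˢ d} (monomial-expansion f≤d) ⟩
    f ⊛ (X-1 ^ˢ d)  ∎
    where open ≋-Reasoning

module BrylawskiPolynomials {c ℓ} (R : CommutativeRing c ℓ) where
  open CommutativeRing R
  open Poly R
  open Sums R
  open PowerSeries R
  open Polynomials R
  open Substitution R
  open UnivariateSubstitution R
  open import Data.Nat.Tactic.RingSolver using (solve-∀)
  open import Algebra.Properties.CommutativeSemigroup S.*-commutativeSemigroup using (x∙yz≈y∙xz)

  module Witness {U : Seq₂} {n : ℕ} {κ : Carrier} {B D p q s : ℕ}
    (κ≉0 : ¬ κ ≈ 0#) (U-supp : Support₂ U B) (B≤D : B ≤ D)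
    (identity : ((X-1 ^ˢ (s ℕ.+ p)) ⊛ substY U B D) ≋ ((X-1 ^ˢ (s ℕ.+ q ℕ.+ D)) ⊛ (cst κ ⊛ (X ^ˢ n)))) where

    B≤1+D : B ≤ suc D
    B≤1+D = ℕP.m≤n⇒m≤1+n B≤D

    identity′ : ((X-1 ^ˢ (s ℕ.+ p)) ⊛ substY U B D) ≋ special κ (s ℕ.+ q ℕ.+ D) n
    identity′ = S.trans identity (x∙yz≈y∙xz (X-1 ^ˢ (s ℕ.+ q ℕ.+ D)) (cst κ) (X ^ˢ n))

    degX≥p-q : ¬ (∀ i j → p ≤ q ℕ.+ i → U i j ≈ 0#)
    degX≥p-q vanish =
      κ≉0 (X-1∣κXⁿ⇒κ≈0 {Q} {n = n} (IsPoly-substY U B d) (X-1ᵐ⊛-cancel (s ℕ.+ q ℕ.+ D) {X-1 ⊛ Q} (begin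
      (X-1 ^ˢ (s ℕ.+ q ℕ.+ D)) ⊛ (X-1 ⊛ Q)              ≈⟨ x∙yz≈y∙xz (X-1 ^ˢ (s ℕ.+ q ℕ.+ D)) X-1 Q ⟩
      X-1 ⊛ ((X-1 ^ˢ (s ℕ.+ q ℕ.+ D)) ⊛ Q)              ≈⟨ S.*-assoc X-1 (X-1 ^ˢ (s ℕ.+ q ℕ.+ D)) Q ⟨
      (X-1 ^ˢ suc (s ℕ.+ q ℕ.+ D)) ⊛ Q                  ≈⟨ substY-rescale (s ℕ.+ p) _ D d termwise ⟨
      (X-1 ^ˢ (s ℕ.+ p)) ⊛ substY U B D                 ≈⟨ identity ⟩
      (X-1 ^ˢ (s ℕ.+ q ℕ.+ D)) ⊛ (cst κ ⊛ (X ^ˢ n))     ∎)))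
      where
        open ≋-Reasoning
        d : ℕ
        d = p ∸ suc q
        Q : Seq
        Q = substY U B d
        termwise : ∀ i j → i < B → U i j ≈ 0# ⊎ (i ≤ D × i ≤ d × s ℕ.+ p ℕ.+ D ≡ suc (s ℕ.+ q ℕ.+ D) ℕ.+ d)
        termwise i j i<B with p ℕP.≤? q ℕ.+ i
        ... | yes p≤q+i = inj₁ (vanish i j p≤q+i)
        ... | no  p≰q+i = inj₂ (ℕP.≤-trans (ℕP.<⇒≤ i<B) B≤D , i≤d , exponents)
          where
            q<p : q < p
            q<p = ℕP.≤-trans (s≤s (ℕP.m≤m+n q i)) (ℕP.≰⇒> p≰q+i)
            i≤d : i ≤ d
            i≤d = ℕP.m+n≤o⇒m≤o∸n i (ℕP.≤-trans (ℕP.≤-reflexive (ℕP.+-comm i (suc q))) (ℕP.≰⇒> p≰q+i))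
            exponents : s ℕ.+ p ℕ.+ D ≡ suc (s ℕ.+ q ℕ.+ D) ℕ.+ d
            exponents = ≡.trans (≡.cong (λ t → s ℕ.+ t ℕ.+ D) (≡.sym (ℕP.m+[n∸m]≡n q<p)))
                                (rearrange s q D d)
              where
                rearrange : ∀ s q D d → s ℕ.+ (suc q ℕ.+ d) ℕ.+ D ≡ suc (s ℕ.+ q ℕ.+ D) ℕ.+ d
                rearrange = solve-∀

    degY≥n+q-p : ¬ (∀ i j → n ℕ.+ q ≤ p ℕ.+ j → U i j ≈ 0#)
    degY≥n+q-p vanish = κ≉0 (begin
      κ                                                  ≈⟨ coeff-special-top κ (s ℕ.+ q ℕ.+ D) n ⟨
      special κ (s ℕ.+ q ℕ.+ D) n K                      ≈⟨ identity′ K ⟨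
      ((X-1 ^ˢ (s ℕ.+ p)) ⊛ substY U B D) K              ≈⟨ ⊛-vanishes (proj₁ (Monic-^ˢ-linear (s ℕ.+ p) Monic-X-1))
                                                                       (substY-DegBelow B≤1+D vanish′) K T≤K∸[s+p] ⟩
      0#                                                 ∎)
      where
        open import Relation.Binary.Reasoning.Setoid setoid
        K = s ℕ.+ q ℕ.+ D ℕ.+ n
        T = q ℕ.+ D ℕ.+ n ∸ p
        vanish′ : ∀ i j → T ≤ j ℕ.+ D → U i j ≈ 0#
        vanish′ i j T≤j+D = vanish i j (ℕP.+-cancelˡ-≤ D _ _ (ℕP.≤-trans (ℕP.≤-reflexive (rearrangeˡ n q D))
                              (ℕP.≤-trans (ℕP.m≤n+m∸n (q ℕ.+ D ℕ.+ n) p)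
                                (ℕP.≤-trans (ℕP.+-monoʳ-≤ p T≤j+D) (ℕP.≤-reflexive (rearrangeʳ p j D))))))
          where
            rearrangeˡ : ∀ n q D → D ℕ.+ (n ℕ.+ q) ≡ q ℕ.+ D ℕ.+ n
            rearrangeˡ = solve-∀
            rearrangeʳ : ∀ p j D → p ℕ.+ (j ℕ.+ D) ≡ D ℕ.+ (p ℕ.+ j)
            rearrangeʳ = solve-∀
        T≤K∸[s+p] : T ≤ K ∸ (s ℕ.+ p)
        T≤K∸[s+p] = ℕP.≤-reflexive (≡.sym (≡.trans (≡.cong (_∸ (s ℕ.+ p)) (reassociate s q D n))
                                                   (ℕP.[m+n]∸[m+o]≡n∸o s (q ℕ.+ D ℕ.+ n) p)))
          where
            reassociate : ∀ s q D n → s ℕ.+ q ℕ.+ D ℕ.+ n ≡ s ℕ.+ (q ℕ.+ D ℕ.+ n)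
            reassociate = solve-∀

    substY-divisor : ∀ {F B₁ D₁ G} → Support₂ F B₁ → B₁ ≤ suc D₁ → IsPoly₂ G → (F ⊛₂ G) ≋₂ U →
                     ∃[ m ] (substY F B₁ D₁ ∣ special κ m n)
    substY-divisor {F} {B₁} {D₁} {G} F-supp B₁≤1+D₁ (B₂ , G-supp) FG≋U =
      e ℕ.+ (s ℕ.+ q ℕ.+ D) ,
      (X-1 ^ˢ (s ℕ.+ p)) ⊛ G̃ , IsPoly-⊛ (IsPoly-X-1ᵏ (s ℕ.+ p)) (IsPoly-substY G B₂ D₂) , (begin
        F̃ ⊛ ((X-1 ^ˢ (s ℕ.+ p)) ⊛ G̃)              ≈⟨ x∙yz≈y∙xz F̃ (X-1 ^ˢ (s ℕ.+ p)) G̃ ⟩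
        (X-1 ^ˢ (s ℕ.+ p)) ⊛ (F̃ ⊛ G̃)              ≈⟨ S.*-congˡ {X-1 ^ˢ (s ℕ.+ p)} product ⟩
        (X-1 ^ˢ (s ℕ.+ p)) ⊛ ((X-1 ^ˢ e) ⊛ P)     ≈⟨ x∙yz≈y∙xz (X-1 ^ˢ (s ℕ.+ p)) (X-1 ^ˢ e) P ⟩
        (X-1 ^ˢ e) ⊛ ((X-1 ^ˢ (s ℕ.+ p)) ⊛ P)     ≈⟨ S.*-congˡ {X-1 ^ˢ e} identity′ ⟩
        (X-1 ^ˢ e) ⊛ special κ (s ℕ.+ q ℕ.+ D) n  ≈⟨ X-1ᵉ⊛special e κ (s ℕ.+ q ℕ.+ D) n ⟩
        special κ (e ℕ.+ (s ℕ.+ q ℕ.+ D)) n       ∎)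
      where
        open ≋-Reasoning
        D₂ = B₂ ℕ.+ D
        e = D₁ ℕ.+ B₂
        P = substY U B D
        F̃ = substY F B₁ D₁
        G̃ = substY G B₂ D₂
        product : (F̃ ⊛ G̃) ≋ ((X-1 ^ˢ e) ⊛ P)
        product = begin
          F̃ ⊛ G̃                               ≈⟨ substY-⊛₂ F-supp G-supp B₁≤1+D₁ (ℕP.m≤n⇒m≤1+n (ℕP.m≤m+n B₂ D)) ⟨
          substY (F ⊛₂ G) (B₁ ℕ.+ B₂) (D₁ ℕ.+ D₂)  ≈⟨ substY-cong (B₁ ℕ.+ B₂) (D₁ ℕ.+ D₂) FG≋U ⟩
          substY U (B₁ ℕ.+ B₂) (D₁ ℕ.+ D₂)         ≈⟨ substY-support-irrelevant (D₁ ℕ.+ D₂)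
                                                      (Support₂-cong FG≋U (Support₂-⊛₂ F-supp G-supp)) U-supp ⟩
          substY U B (D₁ ℕ.+ D₂)                   ≡⟨ ≡.cong (substY U B) (≡.sym (ℕP.+-assoc D₁ B₂ D)) ⟩
          substY U B (e ℕ.+ D)                     ≈⟨ substY-shift e D B≤1+D ⟩
          (X-1 ^ˢ e) ⊛ P                           ∎

    module _ (no-zero-divisors : NoZeroDivisors R) where
      open Divisibility R no-zero-divisors

      DividesX⇒¬¬SpecialForm : ∀ f → IsPoly f → DividesX f U → ¬ ¬ SpecialForm f
      DividesX⇒¬¬SpecialForm f (d , f<d) (G , G-poly , fG≋U) =
        ¬¬-map (λ (a , k , l , a≉0 , f̃≋special) → SpecialForm-substX {k = k} {l} f≤d a≉0 f̃≋special)
               (special-divisor m n κ≉0 (suc d , DegBelow-substX d f) f̃∣special)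
        where
          f≤d = DegBelow-mono (ℕP.n≤1+n d) f<d
          divisor = substY-divisor (Support₂-embedX f≤d) ℕP.≤-refl G-poly fG≋U
          m = proj₁ divisor
          f̃∣special = proj₂ divisor

      DividesY⇒¬¬SpecialForm : ∀ f → IsPoly f → DividesY f U → ¬ ¬ SpecialForm f
      DividesY⇒¬¬SpecialForm f (d , f<d) (G , G-poly , fG≋U) =
        cofactor (substY-divisor (Support₂-embedY f≤d) ℕP.≤-refl G-poly fG≋U)
        where
          f≤d = DegBelow-mono (ℕP.n≤1+n d) f<d
          cofactor : ∃[ m ] (substY (embedY f) (suc d) d ∣ special κ m n) → ¬ ¬ SpecialForm f
          cofactor (m , H , H-poly , f̃H≋special) =
            special-divisor m n κ≉0 (d , f<d) ((X-1 ^ˢ d) ⊛ H , IsPoly-⊛ (IsPoly-X-1ᵏ d) H-poly , (begin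
              f ⊛ ((X-1 ^ˢ d) ⊛ H)             ≈⟨ S.*-assoc f (X-1 ^ˢ d) H ⟨
              (f ⊛ (X-1 ^ˢ d)) ⊛ H             ≈⟨ S.*-congʳ {H} (substY-embedY f≤d) ⟨
              substY (embedY f) (suc d) d ⊛ H  ≈⟨ f̃H≋special ⟩
              special κ m n                     ∎))
            where open ≋-Reasoning

open import Data.Integer as ℤ using (ℤ; +_; _-_; _⊖_)
import Data.Integer.Properties as ℤP

m⊖n≤+o : ∀ {m n o} → m ≤ n ℕ.+ o → m ⊖ n ℤ.≤ + o
m⊖n≤+o {m} {n} {o} m≤n+o =
  ℤP.≤-trans (ℤP.⊖-monoˡ-≤ n m≤n+o)
             (ℤP.≤-reflexive (≡.trans (ℤP.⊖-≥ (ℕP.m≤m+n n o)) (≡.cong +_ (ℕP.m+n∸m≡n n o))))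

p-q≤i : ∀ {p q i} → p ≤ q ℕ.+ i → + p - + q ℤ.≤ + i
p-q≤i {p} {q} p≤q+i = ≡.subst (ℤ._≤ _) (≡.sym (ℤP.[+m]-[+n]≡m⊖n p q)) (m⊖n≤+o p≤q+i)

n-[p-q]≤j : ∀ {n p q j} → n ℕ.+ q ≤ p ℕ.+ j → + n - (+ p - + q) ℤ.≤ + j
n-[p-q]≤j {n} {p} {q} n+q≤p+j = ≡.subst (ℤ._≤ _) (≡.sym n-[p-q]≡n+q⊖p) (m⊖n≤+o n+q≤p+j)
  where
    open import Data.Integer.Tactic.RingSolver using (solve-∀)
    regroup : ∀ n p q → n - (p - q) ≡ (n ℤ.+ q) - p
    regroup = solve-∀
    n-[p-q]≡n+q⊖p : + n - (+ p - + q) ≡ (n ℕ.+ q) ⊖ p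
    n-[p-q]≡n+q⊖p = ≡.trans (regroup (+ n) (+ p) (+ q))
                      (≡.trans (≡.cong (_- + p) (≡.sym (ℤP.pos-+ n q))) (ℤP.[+m]-[+n]≡m⊖n (n ℕ.+ q) p))

proposition2p5 : ∀ {c ℓ} (R : CommutativeRing c ℓ) →
    let open Poly R in
    (U : Seq₂) (n : ℕ) (r : ℤ) (κ : CommutativeRing.Carrier R) →
    IsPoly₂ U → IsBrylawski U n r κ →
    (DegX≥ U r × DegY≥ U (+ n - r)) ×
    (IsUFD →
      (∀ f → IsPoly f → DividesX f U → ¬ ¬ SpecialForm f) ×
      (∀ f → IsPoly f → DividesY f U → ¬ ¬ SpecialForm f))
proposition2p5 R U n r κ _ (κ≉0 , B , U-supp , D , B≤D , p , q , s , ≡.refl , identity) =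
  ( (λ vanish → degX≥p-q (λ i j p≤q+i → vanish i j (p-q≤i p≤q+i)))
  , (λ vanish → degY≥n+q-p (λ i j n+q≤p+j → vanish i j (n-[p-q]≤j {n} {q = q} n+q≤p+j))) )
  , λ ufd → let open Poly.IsUFD ufd in DividesX⇒¬¬SpecialForm noZeroDiv , DividesY⇒¬¬SpecialForm noZeroDiv
  where
    open BrylawskiPolynomials R
    open Witness {n = n} {p = p} {q} {s} κ≉0 U-supp B≤D identity
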